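{- Let $n\ge 3$ and let $P$ be any $n$-bit permutation all of whose row numbers are at normal positions. Let $R$ be the ordered set of gates output by the algorithm $\mathcal{A}'_{\rm red}$ described in the context on input $P$. Then the number of Toffoli gates of $R$ (counted with the conversion convention in the context) is at most $\mathcal{N}_c(n)+\mathcal{N}_a(n)$, where $$\mathcal{N}_c(n)=\sum_{i=2}^{n-1}(2i-3)\cdot 2^{n-i},\qquad \mathcal{N}_a(n)=\sum_{j=2}^{n-2}\sum_{i=2}^{n-j}(2i-3)\binom{n-j}{i},$$ with $\mathcal{N}_a(3)=0$.
   Context: An $n$-bit permutation is a bijection of $\{0,\dots,2^n-1\}$ in one-line notation $P=(r_0,\dots,r_{2^n-1})$; $x$ is the column number, $r_x$ the row number. Integers $x\in\{0,\dots,2^n-1\}$ are identified with $n$-bit strings $x_1\cdots x_n$ ($x_1$ most significant), and block-wise positions $t\in\{0,\dots,2^{n-1}-1\}$ with $(n-1)$-bit strings $t_1\cdots t_{n-1}$ ($t_1$ most significant); note bit $k$ of column $2t$ or $2t+1$ equals $t_k$ for $k\le n-1$. All row numbers are at normal positions means $r_x\equiv x\pmod 2$ for all $x$. Gates: for $I\subseteq\{1,\dots,n\}$, $k\notin I$, $CX_{I:k}$ flips bit $k$ of $x$ when $x_i=1$ for all $i\in I$ (a $C^{|I|}X$ gate); $X_k=CX_{\emptyset:k}$, $CX_{jk}=CX_{\{j\}:k}$. Applying gate $g$ to $P=(r_x)$ gives $(r'_x)$ with $r'_x=r_{g(x)}$. Toffoli count: a $C^kX$ gate with $k\ge 2$ counts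 as $2k-3$ Toffoli gates, and gates with $k\le 1$ count $0$. Let $h_n(x)=2^n-2^{n-x+1}$ and for $0\le i\le 2^{n-1}-1$ let $m(i)$ be the smallest positive integer with $2i\le h_n(m(i))$. Algorithm $\mathcal{A}'_{\rm red}$: start with $R=()$ and the current permutation $P$. For $i=0,1,\dots,2^{n-1}-1$ in order, with $m=m(i)$: (PICK) scan $j=h_n(m),h_n(m)+1,\dots,2^n-2$ in increasing order, set $a=r_j$ and let $b$ be $a$ with its least significant bit flipped; stop at the first $j$ for which $b=r_t$ for some $t>j$, and select $(a,b)$. (CONS) Let $\alpha,\beta$ be the current columns of $a,b$, $\gamma=\alpha\oplus\beta$ (bitwise XOR), $\delta$ the smallest index with $\gamma_\delta=1$. If $\delta\ne n$: if $i_\delta=1$ append $X_\delta$; append $CX_{\delta k}$ for each $k=\delta+1,\dots,n-1$ with $\gamma_k=1$; if $i_\delta=1$ append $X_\delta$; then append $CX_{I:\delta}$ with $I=\{1,\dots,m-1\}\cup\{n\}$; apply these gates to $P$ and append them to $R$. (ALLOC) Let $s=\lfloor\alpha'/2\rfloor$ where $\alpha'$ is the current column of $a$. If $s\ne i$: let $\gamma=s\oplus i$ as $(n-1)$-bit strings and $\delta$ the smallest index with $\gamma_\delta=1$; append $CX_{\delta k}$ for each $k=\delta+1,\dots,n-1$ with $\gamma_k=1$, then append $CX_{I:\delta}$ with $I=\{k:\delta<k\le n-1,\ i_k=1\}$; apply these gates to $P$ and append them to $R$. After the loop, output $R$ (and the final permutation). -}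

module Defs where

open import Data.Nat using (ℕ; zero; suc; _+_; _*_; _∸_; _^_; _≤_; _<_; _<?_; _≤ᵇ_; _≡ᵇ_; ⌊_/2⌋; _%_)
open import Data.Nat.Combinatorics using (_C_)
open import Data.Bool using (Bool; true; false; if_then_else_; not; _∧_)
open import Data.List using (List; []; _∷_; _++_; map; foldl; applyUpTo; upTo; length) renaming (filterᵇ to filter)
open import Data.Nat.ListAction using (sum)
open import Data.Bool.ListAction using (any; all)
open import Data.Maybe using (Maybe; just; nothing)
open import Data.Product using (_×_; _,_; proj₁; proj₂)
open import Data.Fin using (Fin; toℕ; fromℕ<)
open import Data.Fin.Permutation using (Permutation′; _⟨$⟩ʳ_)
open import Relation.Nullary using (yes; no)
open import Relation.Unary using (Decidable)

range : ℕ → ℕ → List ℕ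
range a b = applyUpTo (λ k → a + k) (b ∸ a)

sumFromTo : ℕ → ℕ → (ℕ → ℕ) → ℕ
sumFromTo a b f = sum (map f (range a (suc b)))

firstWith : (ℕ → Bool) → List ℕ → Maybe ℕ
firstWith p [] = nothing
firstWith p (x ∷ xs) = if p x then just x else firstWith p xs

fromMaybe : ℕ → Maybe ℕ → ℕ
fromMaybe d nothing = d
fromMaybe d (just x) = x

shiftR : ℕ → ℕ → ℕ
shiftR x zero = x
shiftR x (suc k) = shiftR ⌊ x /2⌋ k

-- bit k (1 = most significant) of x viewed as an n-bit string
nbit : ℕ → ℕ → ℕ → ℕ
nbit n x k = shiftR x (n ∸ k) % 2

-- bit k (1 = most significant) of t viewed as an (n-1)-bit string
tbit : ℕ → ℕ → ℕ → ℕ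
tbit n t k = shiftR t ((n ∸ 1) ∸ k) % 2

flipBit : ℕ → ℕ → ℕ → ℕ
flipBit n x k = if nbit n x k ≡ᵇ 1 then x ∸ 2 ^ (n ∸ k) else x + 2 ^ (n ∸ k)

-- Gates: CX_{I:k} with control set I (list of bit indices) and target k

record Gate : Set where
  constructor CX
  field
    ctrl : List ℕ
    tgt  : ℕ
open Gate public

gateAct : ℕ → Gate → ℕ → ℕ
gateAct n g x =
  if all (λ i → nbit n x i ≡ᵇ 1) (ctrl g) then flipBit n x (tgt g) else x

-- permutations in one-line notation as functions x ↦ r_x
-- applying gate g to (r_x) gives (r_{g(x)})
applyGate : ℕ → (ℕ → ℕ) → Gate → (ℕ → ℕ)
applyGate n r g x = r (gateAct n g x)

applyGates : ℕ → (ℕ → ℕ) → List Gate → (ℕ → ℕ)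
applyGates n = foldl (applyGate n)

gateCost : Gate → ℕ
gateCost g with 2 ≤ᵇ length (ctrl g)
... | true  = 2 * length (ctrl g) ∸ 3
... | false = 0

toffoliCount : List Gate → ℕ
toffoliCount gs = sum (map gateCost gs)

h : ℕ → ℕ → ℕ
h n x = 2 ^ n ∸ 2 ^ (n ∸ x + 1)

-- smallest positive m with 2i ≤ h_n(m) (always ≤ n for i ≤ 2^{n-1}-1)
mOf : ℕ → ℕ → ℕ
mOf n i = fromMaybe n (firstWith (λ m → 2 * i ≤ᵇ h n m) (range 1 (suc n)))

colOf : ℕ → (ℕ → ℕ) → ℕ → ℕ
colOf n r a = fromMaybe 0 (firstWith (λ x → r x ≡ᵇ a) (range 0 (2 ^ n)))

lsbFlip : ℕ → ℕ
lsbFlip a = if a % 2 ≡ᵇ 0 then suc a else a ∸ 1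

State : Set
State = (ℕ → ℕ) × List Gate

emit : ℕ → List Gate → State → State
emit n gs (r , R) = applyGates n r gs , R ++ gs

-- PICK: returns the selected j (then a = r_j, b = a with LSB flipped)
pickJ : ℕ → ℕ → (ℕ → ℕ) → Maybe ℕ
pickJ n m r =
  firstWith (λ j → any (λ t → r t ≡ᵇ lsbFlip (r j)) (range (suc j) (2 ^ n)))
            (range (h n m) (2 ^ n ∸ 1))

-- CONS gates, from the columns α β of a b
consGates : ℕ → ℕ → ℕ → ℕ → ℕ → List Gate
consGates n m i α β =
  if δ ≡ᵇ n then []
  else xs ++ cxs ++ xs ++ (CX (range 1 m ++ (n ∷ [])) δ ∷ [])
  where
    differ : ℕ → Bool
    differ k = not (nbit n α k ≡ᵇ nbit n β k)
    δ : ℕ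
    δ = fromMaybe n (firstWith differ (range 1 (suc n)))
    xs : List Gate
    xs = if tbit n i δ ≡ᵇ 1 then CX [] δ ∷ [] else []
    cxs : List Gate
    cxs = map (λ k → CX (δ ∷ []) k) (filter (λ k → differ k) (range (suc δ) n))

-- ALLOC gates, from s = ⌊α'/2⌋
allocGates : ℕ → ℕ → ℕ → List Gate
allocGates n i s =
  if s ≡ᵇ i then []
  else map (λ k → CX (δ ∷ []) k) (filter differ (range (suc δ) n))
       ++ (CX (filter (λ k → tbit n i k ≡ᵇ 1) (range (suc δ) n)) δ ∷ [])
  where
    differ : ℕ → Bool
    differ k = not (tbit n s k ≡ᵇ tbit n i k)
    δ : ℕ
    δ = fromMaybe n (firstWith differ (range 1 n))

step : ℕ → State → ℕ → State
step n (r , R) i with pickJ n (mOf n i) r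
... | nothing = (r , R)
... | just j = stateAfterAlloc
  where
    a b : ℕ
    a = r j
    b = lsbFlip a
    stateAfterCons : State
    stateAfterCons =
      emit n (consGates n (mOf n i) i (colOf n r a) (colOf n r b)) (r , R)
    stateAfterAlloc : State
    stateAfterAlloc =
      emit n (allocGates n i ⌊ colOf n (proj₁ stateAfterCons) a /2⌋) stateAfterCons

runAred : ℕ → (ℕ → ℕ) → State
runAred n r = foldl (step n) (r , []) (upTo (2 ^ (n ∸ 1)))

Ared : ℕ → (ℕ → ℕ) → List Gate
Ared n r = proj₂ (runAred n r)

permFun : (n : ℕ) → Permutation′ (2 ^ n) → ℕ → ℕ
permFun n π x with x <? 2 ^ n
... | yes p = toℕ (π ⟨$⟩ʳ fromℕ< p)
... | no _  = x

NormalPositions : (n : ℕ) → Permutation′ (2 ^ n) → Set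
NormalPositions n π = ∀ (x : Fin (2 ^ n)) → toℕ (π ⟨$⟩ʳ x) % 2 ≡ toℕ x % 2
  where open import Relation.Binary.PropositionalEquality using (_≡_)

Nc : ℕ → ℕ
Nc n = sumFromTo 2 (n ∸ 1) (λ i → (2 * i ∸ 3) * 2 ^ (n ∸ i))

Na : ℕ → ℕ
Na n = sumFromTo 2 (n ∸ 2) (λ j → sumFromTo 2 (n ∸ j) (λ i → (2 * i ∸ 3) * ((n ∸ j) C i)))

-- Every iteration i of the loop emits at most two gates with two or more controls. The CONS gate has the
-- m = m(i) controls {1, …, m − 1} ∪ {n}, and it is only emitted when the columns j < t of the chosen pair first
-- differ at a bit δ with m ≤ δ < n (both columns are ≥ h_n(m), so their leading m − 1 bits are 1); it costs
-- 2m − 3, and nothing when m = n. The ALLOC gate is controlled by the 1-bits of i after the first bit δ′ where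
-- i and s = ⌊α′/2⌋ differ. Now s ≥ i: the column of a starts at j ≥ h_n(m) ≥ 2i, and CONS either only sets
-- bit δ of it (if i has a 0 at δ), or keeps its bits above δ while i has a 1 at δ and j has a 0. So i has a 0
-- at δ′, and ALLOC costs at most as much as a gate controlled by the 1-bits of i below its highest 0-bit.
-- Summing over i: m(i) = m for exactly 2^(n−m) values of i when m ≥ 2, which gives N_c(n), and counting the
-- i < 2^L by the number of 1-bits below their highest 0-bit gives the binomial sums of N_a(n).

module Submission where

open import Defs
open import Data.Bool using (Bool; true; false; if_then_else_; T; not; _∧_)
open import Data.Bool.ListAction using (any; all)
open import Data.Empty using (⊥-elim)
open import Data.Fin using (toℕ; fromℕ<)
open import Data.Fin.Properties using (toℕ-injective; toℕ-fromℕ<)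
open import Data.Fin.Permutation using (Permutation′; _⟨$⟩ʳ_; _⟨$⟩ˡ_; inverseˡ)
open import Data.List using (List; []; _∷_; _++_; map; foldl; applyUpTo; upTo; length; filterᵇ)
open import Data.List.Properties using (foldl-++; map-++; length-++; length-applyUpTo)
open import Data.List.Relation.Unary.All using (All; []; _∷_)
open import Data.List.Relation.Unary.All.Properties using (applyUpTo⁺₁; filter⁺; map⁺; ++⁺)
open import Data.Maybe using (just; nothing)
open import Data.Nat
open import Data.Nat.Combinatorics using (_C_; nCk+nC[k+1]≡[n+1]C[k+1]; k>n⇒nCk≡0)
open import Data.Nat.DivMod using ([m+kn]%n≡m%n; m%n<n)
open import Data.Nat.ListAction using (sum)
open import Data.Nat.ListAction.Properties using (sum-++)
open import Data.Nat.Properties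
open import Data.Nat.Tactic.RingSolver using (solve-∀)
open import Data.Product using (_×_; _,_; proj₁; proj₂; ∃-syntax)
open import Data.Sum using (_⊎_; inj₁; inj₂)
open import Function using (_∘_; id)
open import Relation.Binary.Definitions using (tri<; tri≈; tri>)
open import Relation.Binary.PropositionalEquality
open import Relation.Nullary using (yes; no)
open import Relation.Nullary.Decidable using (T?)

if-true : ∀ {A : Set} {b : Bool} {u v : A} → b ≡ true → (if b then u else v) ≡ u
if-true refl = refl

if-false : ∀ {A : Set} {b : Bool} {u v : A} → b ≡ false → (if b then u else v) ≡ v
if-false refl = refl

≡ᵇ-refl : ∀ a → (a ≡ᵇ a) ≡ true
≡ᵇ-refl zero = refl
≡ᵇ-refl (suc a) = ≡ᵇ-refl a

≡ᵇ-true⇒≡ : ∀ a b → (a ≡ᵇ b) ≡ true → a ≡ b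
≡ᵇ-true⇒≡ a b eq = ≡ᵇ⇒≡ a b (subst T (sym eq) _)

≡ᵇ-false⇒≢ : ∀ a b → (a ≡ᵇ b) ≡ false → a ≢ b
≡ᵇ-false⇒≢ a b eq a≡b = subst T eq (≡⇒≡ᵇ a b a≡b)

≢⇒≡ᵇ-false : ∀ a b → a ≢ b → (a ≡ᵇ b) ≡ false
≢⇒≡ᵇ-false a b a≢b with a ≡ᵇ b in eq
... | false = refl
... | true = ⊥-elim (a≢b (≡ᵇ-true⇒≡ a b eq))

≤⇒≤ᵇ≡true : ∀ {a b} → a ≤ b → (a ≤ᵇ b) ≡ true
≤⇒≤ᵇ≡true {a} {b} a≤b with a ≤ᵇ b in eq
... | true = refl
... | false = ⊥-elim (subst T eq (≤⇒≤ᵇ a≤b))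

>⇒≤ᵇ≡false : ∀ {a b} → b < a → (a ≤ᵇ b) ≡ false
>⇒≤ᵇ≡false {a} {b} b<a with a ≤ᵇ b in eq
... | false = refl
... | true = ⊥-elim (<⇒≱ b<a (≤ᵇ⇒≤ a b (subst T (sym eq) _)))

≤ᵇ≡true⇒≤ : ∀ a b → (a ≤ᵇ b) ≡ true → a ≤ b
≤ᵇ≡true⇒≤ a b eq = ≤ᵇ⇒≤ a b (subst T (sym eq) _)

not-≡ᵇ-false⇒≡ : ∀ a b → not (a ≡ᵇ b) ≡ false → a ≡ b
not-≡ᵇ-false⇒≡ a b eq with a ≡ᵇ b in eq′
... | true = ≡ᵇ-true⇒≡ a b eq′

not-≡ᵇ-true⇒≢ : ∀ a b → not (a ≡ᵇ b) ≡ true → a ≢ b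
not-≡ᵇ-true⇒≢ a b eq with a ≡ᵇ b in eq′
... | false = ≡ᵇ-false⇒≢ a b eq′

-- bitAt x e is the bit of weight 2^e; bit k of an n-bit string (1 = most significant) is bitAt x (n ∸ k).
bitAt : ℕ → ℕ → ℕ
bitAt x e = shiftR x e % 2

m%2≡0⊎m%2≡1 : ∀ m → m % 2 ≡ 0 ⊎ m % 2 ≡ 1
m%2≡0⊎m%2≡1 zero = inj₁ refl
m%2≡0⊎m%2≡1 (suc zero) = inj₂ refl
m%2≡0⊎m%2≡1 (suc (suc m)) = m%2≡0⊎m%2≡1 m

m≡m%2+2*⌊m/2⌋ : ∀ m → m ≡ m % 2 + 2 * ⌊ m /2⌋
m≡m%2+2*⌊m/2⌋ zero = refl
m≡m%2+2*⌊m/2⌋ (suc zero) = refl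
m≡m%2+2*⌊m/2⌋ (suc (suc m)) =
  trans (cong (2 +_) (m≡m%2+2*⌊m/2⌋ m)) (shift (m % 2) ⌊ m /2⌋)
  where
  shift : ∀ a b → 2 + (a + 2 * b) ≡ a + 2 * suc b
  shift = solve-∀

⌊m+2n/2⌋≡⌊m/2⌋+n : ∀ m n → ⌊ m + 2 * n /2⌋ ≡ ⌊ m /2⌋ + n
⌊m+2n/2⌋≡⌊m/2⌋+n m zero = trans (cong ⌊_/2⌋ (+-identityʳ m)) (sym (+-identityʳ _))
⌊m+2n/2⌋≡⌊m/2⌋+n m (suc n) = begin
  ⌊ m + 2 * suc n /2⌋      ≡⟨ cong ⌊_/2⌋ (shift m n) ⟩
  suc ⌊ m + 2 * n /2⌋      ≡⟨ cong suc (⌊m+2n/2⌋≡⌊m/2⌋+n m n) ⟩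
  suc (⌊ m /2⌋ + n)        ≡⟨ +-suc _ n ⟨
  ⌊ m /2⌋ + suc n          ∎
  where
  open ≡-Reasoning
  shift : ∀ a b → a + 2 * suc b ≡ 2 + (a + 2 * b)
  shift = solve-∀

[m+2n]%2≡m%2 : ∀ m n → (m + 2 * n) % 2 ≡ m % 2
[m+2n]%2≡m%2 m n = trans (cong (λ k → (m + k) % 2) (*-comm 2 n)) ([m+kn]%n≡m%n m n 2)

2*⌊m/2⌋≤m : ∀ m → 2 * ⌊ m /2⌋ ≤ m
2*⌊m/2⌋≤m m = subst (2 * ⌊ m /2⌋ ≤_) (sym (m≡m%2+2*⌊m/2⌋ m)) (m≤n+m _ (m % 2))

m<2n⇒⌊m/2⌋<n : ∀ m n → m < 2 * n → ⌊ m /2⌋ < n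
m<2n⇒⌊m/2⌋<n m n m<2n = *-cancelˡ-< 2 ⌊ m /2⌋ n (≤-<-trans (2*⌊m/2⌋≤m m) m<2n)

⌊m/2⌋<n⇒m<2n : ∀ m n → ⌊ m /2⌋ < n → m < 2 * n
⌊m/2⌋<n⇒m<2n m n lt = begin-strict
  m                          ≡⟨ m≡m%2+2*⌊m/2⌋ m ⟩
  m % 2 + 2 * ⌊ m /2⌋        <⟨ +-monoˡ-< (2 * ⌊ m /2⌋) (m%n<n m 2) ⟩
  2 + 2 * ⌊ m /2⌋            ≡⟨ *-suc 2 ⌊ m /2⌋ ⟨
  2 * suc ⌊ m /2⌋            ≤⟨ *-monoʳ-≤ 2 lt ⟩
  2 * n                      ∎
  where open ≤-Reasoning

2m≤n⇒m≤⌊n/2⌋ : ∀ m n → 2 * m ≤ n → m ≤ ⌊ n /2⌋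
2m≤n⇒m≤⌊n/2⌋ m n 2m≤n = subst (_≤ ⌊ n /2⌋) (⌊m+2n/2⌋≡⌊m/2⌋+n 0 m) (⌊n/2⌋-mono 2m≤n)

shiftR-+ : ∀ x a b → shiftR x (a + b) ≡ shiftR (shiftR x a) b
shiftR-+ x zero b = refl
shiftR-+ x (suc a) b = shiftR-+ ⌊ x /2⌋ a b

shiftR-suc : ∀ x e → shiftR x (suc e) ≡ ⌊ shiftR x e /2⌋
shiftR-suc x e = trans (cong (shiftR x) (+-comm 1 e)) (shiftR-+ x e 1)

shiftR-mono-≤ : ∀ {x y} e → x ≤ y → shiftR x e ≤ shiftR y e
shiftR-mono-≤ zero x≤y = x≤y
shiftR-mono-≤ (suc e) x≤y = shiftR-mono-≤ e (⌊n/2⌋-mono x≤y)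

shiftR-<⇒< : ∀ {x y} e → shiftR x e < shiftR y e → x < y
shiftR-<⇒< {x} {y} e lt with x <? y
... | yes x<y = x<y
... | no x≮y = ⊥-elim (<⇒≱ lt (shiftR-mono-≤ e (≮⇒≥ x≮y)))

shiftR≡bitAt+2*shiftR-suc : ∀ x e → shiftR x e ≡ bitAt x e + 2 * shiftR x (suc e)
shiftR≡bitAt+2*shiftR-suc x e =
  trans (m≡m%2+2*⌊m/2⌋ (shiftR x e)) (cong (λ z → bitAt x e + 2 * z) (sym (shiftR-suc x e)))

shiftR-+*2^ : ∀ x c e → shiftR (x + c * 2 ^ e) e ≡ shiftR x e + c
shiftR-+*2^ x c zero = cong (x +_) (*-identityʳ c)
shiftR-+*2^ x c (suc e) = begin
  shiftR ⌊ x + c * (2 * 2 ^ e) /2⌋ e   ≡⟨ cong (λ z → shiftR ⌊ x + z /2⌋ e) (reassoc c (2 ^ e)) ⟩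
  shiftR ⌊ x + 2 * (c * 2 ^ e) /2⌋ e   ≡⟨ cong (λ z → shiftR z e) (⌊m+2n/2⌋≡⌊m/2⌋+n x (c * 2 ^ e)) ⟩
  shiftR (⌊ x /2⌋ + c * 2 ^ e) e       ≡⟨ shiftR-+*2^ ⌊ x /2⌋ c e ⟩
  shiftR ⌊ x /2⌋ e + c                 ∎
  where
  open ≡-Reasoning
  reassoc : ∀ a b → a * (2 * b) ≡ 2 * (a * b)
  reassoc = solve-∀

shiftR<2^⇒<2^ : ∀ x e d → shiftR x e < 2 ^ d → x < 2 ^ (e + d)
shiftR<2^⇒<2^ x zero d lt = lt
shiftR<2^⇒<2^ x (suc e) d lt = ⌊m/2⌋<n⇒m<2n x (2 ^ (e + d)) (shiftR<2^⇒<2^ ⌊ x /2⌋ e d lt)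

<2^⇒shiftR<2^ : ∀ x e d → x < 2 ^ (e + d) → shiftR x e < 2 ^ d
<2^⇒shiftR<2^ x zero d lt = lt
<2^⇒shiftR<2^ x (suc e) d lt = <2^⇒shiftR<2^ ⌊ x /2⌋ e d (m<2n⇒⌊m/2⌋<n x (2 ^ (e + d)) lt)

<2^⇒shiftR≡0 : ∀ x e → x < 2 ^ e → shiftR x e ≡ 0
<2^⇒shiftR≡0 x e lt =
  n<1⇒n≡0 (<2^⇒shiftR<2^ x e 0 (subst (λ z → x < 2 ^ z) (sym (+-identityʳ e)) lt))

first-difference-bitAt≡0 : ∀ {x y} e → x ≤ y → shiftR x (suc e) ≡ shiftR y (suc e) →
                           bitAt x e ≢ bitAt y e → bitAt x e ≡ 0
first-difference-bitAt≡0 {x} {y} e x≤y prefix differ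
  with m%2≡0⊎m%2≡1 (shiftR x e) | m%2≡0⊎m%2≡1 (shiftR y e)
... | inj₁ x0 | _      = x0
... | inj₂ x1 | inj₂ y1 = ⊥-elim (differ (trans x1 (sym y1)))
... | inj₂ x1 | inj₁ y0 = ⊥-elim (<⇒≱ (shiftR-<⇒< e y<x) x≤y)
  where
  y<x : shiftR y e < shiftR x e
  y<x = begin-strict
    shiftR y e                          ≡⟨ shiftR≡bitAt+2*shiftR-suc y e ⟩
    bitAt y e + 2 * shiftR y (suc e)    ≡⟨ cong₂ (λ b p → b + 2 * p) y0 (sym prefix) ⟩
    0 + 2 * shiftR x (suc e)            <⟨ n<1+n _ ⟩
    1 + 2 * shiftR x (suc e)            ≡⟨ cong (_+ 2 * shiftR x (suc e)) x1 ⟨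
    bitAt x e + 2 * shiftR x (suc e)    ≡⟨ shiftR≡bitAt+2*shiftR-suc x e ⟨
    shiftR x e                          ∎
    where open ≤-Reasoning

bit-1-0⇒shiftR-suc-< : ∀ {x y} e → x ≤ y → bitAt x e ≡ 1 → bitAt y e ≡ 0 →
                        shiftR x (suc e) < shiftR y (suc e)
bit-1-0⇒shiftR-suc-< {x} {y} e x≤y x1 y0 =
  *-cancelˡ-< 2 (shiftR x (suc e)) (shiftR y (suc e)) (subst₂ _≤_
    (trans (shiftR≡bitAt+2*shiftR-suc x e) (cong (_+ 2 * shiftR x (suc e)) x1))
    (trans (shiftR≡bitAt+2*shiftR-suc y e) (cong (_+ 2 * shiftR y (suc e)) y0))
    (shiftR-mono-≤ e x≤y))

[2^k∸1]%2≡1 : ∀ k → 1 ≤ k → (2 ^ k ∸ 1) % 2 ≡ 1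
[2^k∸1]%2≡1 (suc k) _ = begin
  (2 * 2 ^ k ∸ 1) % 2                  ≡⟨ cong (λ z → (2 * z ∸ 1) % 2) (m∸n+n≡m (m^n>0 2 k)) ⟨
  (2 * (2 ^ k ∸ 1 + 1) ∸ 1) % 2        ≡⟨ cong (_% 2) (odd (2 ^ k ∸ 1)) ⟩
  (1 + 2 * (2 ^ k ∸ 1)) % 2            ≡⟨ [m+2n]%2≡m%2 1 (2 ^ k ∸ 1) ⟩
  1                                    ∎
  where
  open ≡-Reasoning
  odd : ∀ a → 2 * (a + 1) ∸ 1 ≡ 1 + 2 * a
  odd a = cong (_∸ 1) (trans (*-distribˡ-+ 2 a 1) (+-comm (2 * a) 2))

bitAt-top-block : ∀ e k x → 1 ≤ k → 2 ^ (e + k) ∸ 2 ^ e ≤ x → x < 2 ^ (e + k) → bitAt x e ≡ 1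
bitAt-top-block e k x 1≤k lo hi = trans (cong (_% 2) shiftR≡) ([2^k∸1]%2≡1 k 1≤k)
  where
  lo≡ : 2 ^ (e + k) ∸ 2 ^ e ≡ 0 + (2 ^ k ∸ 1) * 2 ^ e
  lo≡ = begin
    2 ^ (e + k) ∸ 2 ^ e            ≡⟨ cong₂ _∸_ (trans (^-distribˡ-+-* 2 e k) (*-comm (2 ^ e) (2 ^ k)))
                                                (sym (*-identityˡ (2 ^ e))) ⟩
    2 ^ k * 2 ^ e ∸ 1 * 2 ^ e      ≡⟨ *-distribʳ-∸ (2 ^ e) (2 ^ k) 1 ⟨
    (2 ^ k ∸ 1) * 2 ^ e            ∎
    where open ≡-Reasoning
  low : 2 ^ k ∸ 1 ≤ shiftR x e
  low = subst (_≤ shiftR x e)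
          (trans (shiftR-+*2^ 0 (2 ^ k ∸ 1) e) (cong (_+ (2 ^ k ∸ 1)) (<2^⇒shiftR≡0 0 e (m^n>0 2 e))))
          (shiftR-mono-≤ e (subst (_≤ x) lo≡ lo))
  shiftR≡ : shiftR x e ≡ 2 ^ k ∸ 1
  shiftR≡ = ≤-antisym (<⇒≤pred (<2^⇒shiftR<2^ x e k hi)) low

bitAt-agree⇒shiftR≡ : ∀ x y E d → x < 2 ^ (E + d) → y < 2 ^ (E + d) →
  (∀ e → E ≤ e → e < E + d → bitAt x e ≡ bitAt y e) → shiftR x E ≡ shiftR y E
bitAt-agree⇒shiftR≡ x y E zero x< y< _ =
  trans (<2^⇒shiftR≡0 x E (subst (λ z → x < 2 ^ z) (+-identityʳ E) x<))
        (sym (<2^⇒shiftR≡0 y E (subst (λ z → y < 2 ^ z) (+-identityʳ E) y<)))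
bitAt-agree⇒shiftR≡ x y E (suc d) x< y< agree = begin
  shiftR x E                          ≡⟨ shiftR≡bitAt+2*shiftR-suc x E ⟩
  bitAt x E + 2 * shiftR x (suc E)    ≡⟨ cong₂ (λ b q → b + 2 * q) (agree E ≤-refl (m<m+n E z<s)) higher ⟩
  bitAt y E + 2 * shiftR y (suc E)    ≡⟨ shiftR≡bitAt+2*shiftR-suc y E ⟨
  shiftR y E                          ∎
  where
  open ≡-Reasoning
  E+d≡ : E + suc d ≡ suc E + d
  E+d≡ = +-suc E d
  higher : shiftR x (suc E) ≡ shiftR y (suc E)
  higher = bitAt-agree⇒shiftR≡ x y (suc E) d
             (subst (λ z → x < 2 ^ z) E+d≡ x<) (subst (λ z → y < 2 ^ z) E+d≡ y<)
             (λ e E<e e< → agree e (<⇒≤ E<e) (subst (e <_) (sym E+d≡) e<))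

nbit-agree⇒shiftR≡ : ∀ N x y δ → x < 2 ^ N → y < 2 ^ N → 1 ≤ δ → δ ≤ N →
  (∀ k → 1 ≤ k → k < δ → bitAt x (N ∸ k) ≡ bitAt y (N ∸ k)) →
  shiftR x (suc (N ∸ δ)) ≡ shiftR y (suc (N ∸ δ))
nbit-agree⇒shiftR≡ N x y δ x< y< 1≤δ δ≤N agree =
  bitAt-agree⇒shiftR≡ x y E (δ ∸ 1)
    (subst (λ z → x < 2 ^ z) (sym E+d≡N) x<) (subst (λ z → y < 2 ^ z) (sym E+d≡N) y<) agree′
  where
  E : ℕ
  E = suc (N ∸ δ)
  E+d≡N : E + (δ ∸ 1) ≡ N
  E+d≡N = trans (sym (+-suc (N ∸ δ) (δ ∸ 1))) (trans (cong (N ∸ δ +_) (m+[n∸m]≡n 1≤δ)) (m∸n+n≡m δ≤N))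
  agree′ : ∀ e → E ≤ e → e < E + (δ ∸ 1) → bitAt x e ≡ bitAt y e
  agree′ e E≤e e< =
    subst (λ z → bitAt x z ≡ bitAt y z) (m∸[m∸n]≡n (<⇒≤ e<N)) (agree (N ∸ e) (m<n⇒0<n∸m e<N) N∸e<δ)
    where
    e<N : e < N
    e<N = subst (e <_) E+d≡N e<
    N∸e<δ : N ∸ e < δ
    N∸e<δ = begin-strict
      N ∸ e                ≤⟨ ∸-monoʳ-≤ N E≤e ⟩
      N ∸ suc (N ∸ δ)      ≡⟨ pred[m∸n]≡m∸[1+n] N (N ∸ δ) ⟨
      pred (N ∸ (N ∸ δ))   ≡⟨ cong pred (m∸[m∸n]≡n δ≤N) ⟩
      pred δ               <⟨ pred< 1≤δ ⟩
      δ                    ∎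
      where
      open ≤-Reasoning
      pred< : ∀ {a} → 1 ≤ a → pred a < a
      pred< {suc a} _ = ≤-refl

[1+m]%2≡1∸m%2 : ∀ m → suc m % 2 ≡ 1 ∸ m % 2
[1+m]%2≡1∸m%2 zero = refl
[1+m]%2≡1∸m%2 (suc zero) = refl
[1+m]%2≡1∸m%2 (suc (suc m)) = [1+m]%2≡1∸m%2 m

shiftR-+2^ : ∀ y e → shiftR (y + 2 ^ e) e ≡ suc (shiftR y e)
shiftR-+2^ y e = begin
  shiftR (y + 2 ^ e) e       ≡⟨ cong (λ z → shiftR (y + z) e) (*-identityˡ (2 ^ e)) ⟨
  shiftR (y + 1 * 2 ^ e) e   ≡⟨ shiftR-+*2^ y 1 e ⟩
  shiftR y e + 1             ≡⟨ +-comm _ 1 ⟩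
  suc (shiftR y e)           ∎
  where open ≡-Reasoning

bitAt-+2^ : ∀ y e → bitAt (y + 2 ^ e) e ≡ 1 ∸ bitAt y e
bitAt-+2^ y e = trans (cong (_% 2) (shiftR-+2^ y e)) ([1+m]%2≡1∸m%2 (shiftR y e))

shiftR-+2^-above : ∀ y {e e'} → bitAt y e ≡ 0 → e < e' → shiftR (y + 2 ^ e) e' ≡ shiftR y e'
shiftR-+2^-above y {e} {e'} y₀ e<e' = begin
  shiftR (y + 2 ^ e) e'                    ≡⟨ cong (shiftR (y + 2 ^ e)) e'≡ ⟨
  shiftR (y + 2 ^ e) (suc e + d)           ≡⟨ shiftR-+ (y + 2 ^ e) (suc e) d ⟩
  shiftR (shiftR (y + 2 ^ e) (suc e)) d    ≡⟨ cong (λ z → shiftR z d) carry-free ⟩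
  shiftR (shiftR y (suc e)) d              ≡⟨ shiftR-+ y (suc e) d ⟨
  shiftR y (suc e + d)                     ≡⟨ cong (shiftR y) e'≡ ⟩
  shiftR y e'                              ∎
  where
  open ≡-Reasoning
  d : ℕ
  d = e' ∸ suc e
  e'≡ : suc e + d ≡ e'
  e'≡ = m+[n∸m]≡n e<e'
  carry-free : shiftR (y + 2 ^ e) (suc e) ≡ shiftR y (suc e)
  carry-free = begin
    shiftR (y + 2 ^ e) (suc e)               ≡⟨ trans (shiftR-suc _ e) (cong ⌊_/2⌋ (shiftR-+2^ y e)) ⟩
    ⌊ suc (shiftR y e) /2⌋                   ≡⟨ cong (λ z → ⌊ suc z /2⌋) (shiftR≡bitAt+2*shiftR-suc y e) ⟩
    ⌊ suc (bitAt y e + 2 * shiftR y (suc e)) /2⌋ ≡⟨ cong (λ b → ⌊ suc (b + 2 * shiftR y (suc e)) /2⌋) y₀ ⟩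
    ⌊ 1 + 2 * shiftR y (suc e) /2⌋           ≡⟨ ⌊m+2n/2⌋≡⌊m/2⌋+n 1 (shiftR y (suc e)) ⟩
    shiftR y (suc e)                         ∎

bitAt-+2^-below : ∀ y {e e'} → e' < e → bitAt (y + 2 ^ e) e' ≡ bitAt y e'
bitAt-+2^-below y {e} {e'} e'<e = begin
  shiftR (y + 2 ^ e) e' % 2                   ≡⟨ cong (λ z → shiftR (y + z) e' % 2) 2^e≡ ⟩
  shiftR (y + 2 * 2 ^ d * 2 ^ e') e' % 2      ≡⟨ cong (_% 2) (shiftR-+*2^ y (2 * 2 ^ d) e') ⟩
  (shiftR y e' + 2 * 2 ^ d) % 2               ≡⟨ [m+2n]%2≡m%2 (shiftR y e') (2 ^ d) ⟩
  bitAt y e'                                  ∎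
  where
  open ≡-Reasoning
  d : ℕ
  d = e ∸ suc e'
  2^e≡ : 2 ^ e ≡ 2 * 2 ^ d * 2 ^ e'
  2^e≡ = trans (cong (2 ^_) (sym (trans (sym (+-suc d e')) (m∸n+n≡m e'<e)))) (^-distribˡ-+-* 2 (suc d) e')

bitAt-+2^-other : ∀ y {e e'} → bitAt y e ≡ 0 → e' ≢ e → bitAt (y + 2 ^ e) e' ≡ bitAt y e'
bitAt-+2^-other y {e} {e'} y₀ e'≢e with <-cmp e' e
... | tri< e'<e _ _ = bitAt-+2^-below y e'<e
... | tri≈ _ e'≡e _ = ⊥-elim (e'≢e e'≡e)
... | tri> _ _ e<e' = cong (_% 2) (shiftR-+2^-above y y₀ e<e')

data FlipView (n x k : ℕ) : Set where
  set   : bitAt x (n ∸ k) ≡ 0 → flipBit n x k ≡ x + 2 ^ (n ∸ k) → FlipView n x k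
  clear : ∀ y → bitAt y (n ∸ k) ≡ 0 → x ≡ y + 2 ^ (n ∸ k) → flipBit n x k ≡ y → FlipView n x k

flipBit-when-0 : ∀ n x k → bitAt x (n ∸ k) ≡ 0 → flipBit n x k ≡ x + 2 ^ (n ∸ k)
flipBit-when-0 n x k x₀ = cong (λ b → if b ≡ᵇ 1 then x ∸ 2 ^ (n ∸ k) else x + 2 ^ (n ∸ k)) x₀

flipBit-when-1 : ∀ n x k → bitAt x (n ∸ k) ≡ 1 → flipBit n x k ≡ x ∸ 2 ^ (n ∸ k)
flipBit-when-1 n x k x₁ = cong (λ b → if b ≡ᵇ 1 then x ∸ 2 ^ (n ∸ k) else x + 2 ^ (n ∸ k)) x₁

flipView : ∀ n x k → FlipView n x k
flipView n x k with m%2≡0⊎m%2≡1 (shiftR x (n ∸ k))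
... | inj₁ x₀ = set x₀ (flipBit-when-0 n x k x₀)
... | inj₂ x₁ = clear y y₀ (sym (m∸n+n≡m 2^e≤x)) (flipBit-when-1 n x k x₁)
  where
  e y : ℕ
  e = n ∸ k
  y = x ∸ 2 ^ e
  2^e≤x : 2 ^ e ≤ x
  2^e≤x with 2 ^ e ≤? x
  ... | yes le = le
  ... | no ≰ = ⊥-elim (0≢1+n (trans (sym (cong (_% 2) (<2^⇒shiftR≡0 x e (≰⇒> ≰)))) x₁))
  y₀ : bitAt y e ≡ 0
  y₀ with m%2≡0⊎m%2≡1 (shiftR y e)
  ... | inj₁ b₀ = b₀
  ... | inj₂ b₁ = ⊥-elim (0≢1+n (trans (sym x₀) x₁))
    where
    x₀ : bitAt x e ≡ 0
    x₀ = trans (cong (λ z → bitAt z e) (sym (m∸n+n≡m 2^e≤x)))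
               (trans (bitAt-+2^ y e) (cong (1 ∸_) b₁))

flipBit-other : ∀ n x k {e'} → e' ≢ n ∸ k → bitAt (flipBit n x k) e' ≡ bitAt x e'
flipBit-other n x k {e'} e'≢ with flipView n x k
... | set x₀ eq = trans (cong (λ z → bitAt z e') eq) (bitAt-+2^-other x x₀ e'≢)
... | clear y y₀ x≡ eq = trans (cong (λ z → bitAt z e') eq)
        (sym (trans (cong (λ z → bitAt z e') x≡) (bitAt-+2^-other y y₀ e'≢)))

flipBit-above : ∀ n x k {e'} → n ∸ k < e' → shiftR (flipBit n x k) e' ≡ shiftR x e'
flipBit-above n x k {e'} lt with flipView n x k
... | set x₀ eq = trans (cong (λ z → shiftR z e') eq) (shiftR-+2^-above x x₀ lt)
... | clear y y₀ x≡ eq = trans (cong (λ z → shiftR z e') eq)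
        (sym (trans (cong (λ z → shiftR z e') x≡) (shiftR-+2^-above y y₀ lt)))

flipBit-involutive : ∀ n x k → flipBit n (flipBit n x k) k ≡ x
flipBit-involutive n x k with flipView n x k
... | set x₀ eq = trans (cong (λ z → flipBit n z k) eq)
        (trans (flipBit-when-1 n _ k (trans (bitAt-+2^ x (n ∸ k)) (cong (1 ∸_) x₀)))
               (m+n∸n≡m x (2 ^ (n ∸ k))))
... | clear y y₀ x≡ eq = trans (cong (λ z → flipBit n z k) eq) (trans (flipBit-when-0 n y k y₀) (sym x≡))

flipBit-<2^ : ∀ n x k → 1 ≤ k → k ≤ n → x < 2 ^ n → flipBit n x k < 2 ^ n
flipBit-<2^ n x k 1≤k k≤n x< with flipView n x k
... | clear y y₀ x≡ eq = subst (_< 2 ^ n) (sym eq) (≤-<-trans (subst (y ≤_) (sym x≡) (m≤m+n y _)) x<)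
... | set x₀ eq = subst (_< 2 ^ n) (sym eq) (subst (λ z → x + 2 ^ e < 2 ^ z) n≡
        (shiftR<2^⇒<2^ (x + 2 ^ e) (suc e) (k ∸ 1)
          (subst (_< 2 ^ (k ∸ 1)) (sym (shiftR-+2^-above x {e} x₀ ≤-refl))
            (<2^⇒shiftR<2^ x (suc e) (k ∸ 1) (subst (λ z → x < 2 ^ z) (sym n≡) x<)))))
  where
  e : ℕ
  e = n ∸ k
  n≡ : suc e + (k ∸ 1) ≡ n
  n≡ = trans (sym (+-suc e (k ∸ 1))) (trans (cong (e +_) (m+[n∸m]≡n 1≤k)) (m∸n+n≡m k≤n))

record FirstMatch (p : ℕ → Bool) (f : ℕ → ℕ) (K x : ℕ) : Set where
  field
    index   : ℕ
    index<K : index < K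
    x≡      : x ≡ f index
    matches : p x ≡ true
    earlier : ∀ j → j < index → p (f j) ≡ false

firstWith-just⇒FirstMatch : ∀ (p : ℕ → Bool) (f : ℕ → ℕ) K {x} →
                            firstWith p (applyUpTo f K) ≡ just x → FirstMatch p f K x
firstWith-just⇒FirstMatch p f (suc K) eq with p (f 0) in p₀
firstWith-just⇒FirstMatch p f (suc K) refl | true = record
  { index = 0 ; index<K = z<s ; x≡ = refl ; matches = p₀ ; earlier = λ _ () }
... | false = record
  { index = suc index ; index<K = s<s index<K ; x≡ = x≡ ; matches = matches ; earlier = earlier′ }
  where
  open FirstMatch (firstWith-just⇒FirstMatch p (f ∘ suc) K eq)
  earlier′ : ∀ j → j < suc index → p (f j) ≡ false
  earlier′ zero _ = p₀
  earlier′ (suc j) (s<s j<) = earlier j j<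

firstWith-applyUpTo : ∀ (p : ℕ → Bool) (f : ℕ → ℕ) K j → j < K → p (f j) ≡ true →
                      (∀ j′ → j′ < j → p (f j′) ≡ false) → firstWith p (applyUpTo f K) ≡ just (f j)
firstWith-applyUpTo p f (suc K) zero _ pj _ = if-true pj
firstWith-applyUpTo p f (suc K) (suc j) (s<s j<K) pj earlier =
  trans (if-false (earlier 0 z<s))
        (firstWith-applyUpTo p (f ∘ suc) K j j<K pj (λ j′ j′< → earlier (suc j′) (s<s j′<)))

firstWith-nothing : ∀ (p : ℕ → Bool) (f : ℕ → ℕ) K → firstWith p (applyUpTo f K) ≡ nothing →
                    ∀ j → j < K → p (f j) ≡ false
firstWith-nothing p f (suc K) none j j<K with p (f 0) in p₀
firstWith-nothing p f (suc K) none zero _ | false = p₀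
firstWith-nothing p f (suc K) none (suc j) (s<s j<K) | false = firstWith-nothing p (f ∘ suc) K none j j<K

any-applyUpTo⇒∃ : ∀ (p : ℕ → Bool) (f : ℕ → ℕ) K → any p (applyUpTo f K) ≡ true →
                  ∃[ j ] (j < K × p (f j) ≡ true)
any-applyUpTo⇒∃ p f (suc K) eq with p (f 0) in p₀
... | true = 0 , z<s , p₀
... | false with any-applyUpTo⇒∃ p (f ∘ suc) K eq
...   | j , j<K , pj = suc j , s<s j<K , pj

j<b∸a⇒a+j<b : ∀ a b {j} → j < b ∸ a → a + j < b
j<b∸a⇒a+j<b a b {j} lt with a ≤? b
... | yes a≤b = subst (a + j <_) (m+[n∸m]≡n a≤b) (+-monoʳ-< a lt)
... | no a≰b = ⊥-elim (n≮0 (subst (j <_) (m≤n⇒m∸n≡0 (≰⇒≥ a≰b)) lt))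

range-∷ : ∀ a b → a < b → range a b ≡ a ∷ range (suc a) b
range-∷ a (suc b) (s≤s a≤b) = begin
  applyUpTo (a +_) (suc b ∸ a)           ≡⟨ cong (applyUpTo (a +_)) (+-∸-assoc 1 a≤b) ⟩
  applyUpTo (a +_) (suc (b ∸ a))         ≡⟨ cong₂ _∷_ (+-identityʳ a) (applyUpTo-cong (b ∸ a) (+-suc a)) ⟩
  a ∷ applyUpTo (suc a +_) (b ∸ a)       ∎
  where
  open ≡-Reasoning
  applyUpTo-cong : ∀ {f g : ℕ → ℕ} K → (∀ k → f k ≡ g k) → applyUpTo f K ≡ applyUpTo g K
  applyUpTo-cong zero _ = refl
  applyUpTo-cong (suc K) f≗g = cong₂ _∷_ (f≗g 0) (applyUpTo-cong K (f≗g ∘ suc))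

range-empty : ∀ a b → b ≤ a → range a b ≡ []
range-empty a b b≤a = cong (applyUpTo (a +_)) (m≤n⇒m∸n≡0 b≤a)

All-range : ∀ {P : ℕ → Set} a b → (∀ x → a ≤ x → x < b → P x) → All P (range a b)
All-range a b P-in = applyUpTo⁺₁ (a +_) (b ∸ a) (λ {j} j< → P-in (a + j) (m≤m+n a j) (j<b∸a⇒a+j<b a b j<))

All-filterᵇ : ∀ {P : ℕ → Set} (p : ℕ → Bool) {xs} → All P xs → All P (filterᵇ p xs)
All-filterᵇ p = filter⁺ (T? ∘ p)

record ValidGate (n : ℕ) (g : Gate) : Set where
  constructor valid
  field
    1≤tgt    : 1 ≤ tgt g
    tgt≤n    : tgt g ≤ n
    controls : All (λ c → c ≤ n × c ≢ tgt g) (ctrl g)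

X-valid : ∀ {n δ} → 1 ≤ δ → δ ≤ n → ValidGate n (CX [] δ)
X-valid 1≤δ δ≤n = valid 1≤δ δ≤n []

CNOT-valid : ∀ {n δ k} → δ < k → k ≤ n → ValidGate n (CX (δ ∷ []) k)
CNOT-valid δ<k k≤n = valid (≤-trans (s≤s z≤n) δ<k) k≤n ((≤-trans (<⇒≤ δ<k) k≤n , λ δ≡k → <-irrefl δ≡k δ<k) ∷ [])

n∸-injective : ∀ n {c t} → c ≤ n → t ≤ n → n ∸ c ≡ n ∸ t → c ≡ t
n∸-injective n {c} {t} c≤n t≤n eq =
  trans (sym (m∸[m∸n]≡n c≤n)) (trans (cong (n ∸_) eq) (m∸[m∸n]≡n t≤n))

controls-flipBit : ∀ n x t cs → t ≤ n → All (λ c → c ≤ n × c ≢ t) cs →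
  all (λ c → nbit n (flipBit n x t) c ≡ᵇ 1) cs ≡ all (λ c → nbit n x c ≡ᵇ 1) cs
controls-flipBit n x t [] t≤n [] = refl
controls-flipBit n x t (c ∷ cs) t≤n ((c≤n , c≢t) ∷ ok) =
  cong₂ (λ b rest → (b ≡ᵇ 1) ∧ rest)
    (flipBit-other n x t (c≢t ∘ n∸-injective n c≤n t≤n))
    (controls-flipBit n x t cs t≤n ok)

gateAct-involutive : ∀ n g x → ValidGate n g → gateAct n g (gateAct n g x) ≡ x
gateAct-involutive n (CX cs t) x (valid _ t≤n ok) with all (λ c → nbit n x c ≡ᵇ 1) cs in fires
... | true = trans (if-true (trans (controls-flipBit n x t cs t≤n ok) fires)) (flipBit-involutive n x t)
... | false = if-false fires

gateAct-<2^ : ∀ n g x → ValidGate n g → x < 2 ^ n → gateAct n g x < 2 ^ n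
gateAct-<2^ n (CX cs t) x (valid 1≤t t≤n _) x< with all (λ c → nbit n x c ≡ᵇ 1) cs
... | true = flipBit-<2^ n x t 1≤t t≤n x<
... | false = x<

gateAct-above : ∀ n g x {δ} → δ ≤ tgt g →
  shiftR (gateAct n g x) (suc (n ∸ δ)) ≡ shiftR x (suc (n ∸ δ))
gateAct-above n (CX cs t) x δ≤t with all (λ c → nbit n x c ≡ᵇ 1) cs
... | true = flipBit-above n x t (s≤s (∸-monoʳ-≤ n δ≤t))
... | false = refl

gateAct-≥ : ∀ n g x → bitAt x (n ∸ tgt g) ≡ 0 → x ≤ gateAct n g x
gateAct-≥ n (CX cs t) x x₀ with all (λ c → nbit n x c ≡ᵇ 1) cs
... | true = subst (x ≤_) (sym (flipBit-when-0 n x t x₀)) (m≤m+n x _)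
... | false = ≤-refl

-- Applying a valid gate g moves the entry in column x to column gateAct n g x, since g is an involution.
moveCol : ℕ → List Gate → ℕ → ℕ
moveCol n gs x = foldl (λ c g → gateAct n g c) x gs

moveCol-++ : ∀ n gs hs x → moveCol n (gs ++ hs) x ≡ moveCol n hs (moveCol n gs x)
moveCol-++ n gs hs x = foldl-++ (λ c g → gateAct n g c) x gs hs

moveCol-<2^ : ∀ n gs x → All (ValidGate n) gs → x < 2 ^ n → moveCol n gs x < 2 ^ n
moveCol-<2^ n [] x [] x< = x<
moveCol-<2^ n (g ∷ gs) x (v ∷ vs) x< = moveCol-<2^ n gs (gateAct n g x) vs (gateAct-<2^ n g x v x<)

moveCol-above : ∀ n gs x {δ} → All (λ g → δ ≤ tgt g) gs →
  shiftR (moveCol n gs x) (suc (n ∸ δ)) ≡ shiftR x (suc (n ∸ δ))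
moveCol-above n [] x [] = refl
moveCol-above n (g ∷ gs) x (δ≤ ∷ δ≤s) =
  trans (moveCol-above n gs (gateAct n g x) δ≤s) (gateAct-above n g x δ≤)

applyGates-moveCol : ∀ n r gs x → All (ValidGate n) gs → applyGates n r gs (moveCol n gs x) ≡ r x
applyGates-moveCol n r [] x [] = refl
applyGates-moveCol n r (g ∷ gs) x (v ∷ vs) =
  trans (applyGates-moveCol n (applyGate n r g) gs (gateAct n g x) vs) (cong r (gateAct-involutive n g x v))

InjectiveOn : ℕ → (ℕ → ℕ) → Set
InjectiveOn n r = ∀ x y → x < 2 ^ n → y < 2 ^ n → r x ≡ r y → x ≡ y

applyGates-injectiveOn : ∀ n r gs → All (ValidGate n) gs → InjectiveOn n r → InjectiveOn n (applyGates n r gs)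
applyGates-injectiveOn n r [] [] inj = inj
applyGates-injectiveOn n r (g ∷ gs) (v ∷ vs) inj = applyGates-injectiveOn n (applyGate n r g) gs vs inj′
  where
  inj′ : InjectiveOn n (applyGate n r g)
  inj′ x y x< y< eq = begin
    x                               ≡⟨ gateAct-involutive n g x v ⟨
    gateAct n g (gateAct n g x)     ≡⟨ cong (gateAct n g) (inj _ _ (gateAct-<2^ n g x v x<)
                                                                  (gateAct-<2^ n g y v y<) eq) ⟩
    gateAct n g (gateAct n g y)     ≡⟨ gateAct-involutive n g y v ⟩
    y                               ∎
    where open ≡-Reasoning

colOf-row : ∀ n r x → InjectiveOn n r → x < 2 ^ n → colOf n r (r x) ≡ x
colOf-row n r x inj x< = cong (fromMaybe 0)
  (firstWith-applyUpTo (λ y → r y ≡ᵇ r x) (0 +_) (2 ^ n) x x< (≡ᵇ-refl (r x)) earlier)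
  where
  earlier : ∀ y → y < x → (r y ≡ᵇ r x) ≡ false
  earlier y y<x with r y ≡ᵇ r x in eq
  ... | false = refl
  ... | true = ⊥-elim (<-irrefl (inj y x (<-trans y<x x<) x< (≡ᵇ-true⇒≡ (r y) (r x) eq)) y<x)

colOf-applyGates : ∀ n r gs x → InjectiveOn n r → All (ValidGate n) gs → x < 2 ^ n →
  colOf n (applyGates n r gs) (r x) ≡ moveCol n gs x
colOf-applyGates n r gs x inj vs x< =
  trans (cong (colOf n (applyGates n r gs)) (sym (applyGates-moveCol n r gs x vs)))
        (colOf-row n (applyGates n r gs) (moveCol n gs x) (applyGates-injectiveOn n r gs vs inj) (moveCol-<2^ n gs x vs x<))

-- The cost 2k ∸ 3 of a C^k X gate is 0 for k ≤ 1 thanks to truncated subtraction.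
toffoliCost : ℕ → ℕ
toffoliCost k = 2 * k ∸ 3

gateCost≡toffoliCost : ∀ g → gateCost g ≡ toffoliCost (length (ctrl g))
gateCost≡toffoliCost g with 2 ≤ᵇ length (ctrl g) in few
... | true = refl
... | false with length (ctrl g)
...   | zero = refl
...   | suc zero = refl
...   | suc (suc k) = ⊥-elim (subst T few _)

toffoliCost-mono-≤ : ∀ {a b} → a ≤ b → toffoliCost a ≤ toffoliCost b
toffoliCost-mono-≤ a≤b = ∸-monoˡ-≤ 3 (*-monoʳ-≤ 2 a≤b)

toffoliCount-++ : ∀ gs hs → toffoliCount (gs ++ hs) ≡ toffoliCount gs + toffoliCount hs
toffoliCount-++ gs hs = trans (cong sum (map-++ gateCost gs hs)) (sum-++ (map gateCost gs) (map gateCost hs))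

toffoliCount-++-++ : ∀ R gs hs → toffoliCount ((R ++ gs) ++ hs) ≡ toffoliCount R + (toffoliCount gs + toffoliCount hs)
toffoliCount-++-++ R gs hs = trans (toffoliCount-++ (R ++ gs) hs)
  (trans (cong (_+ toffoliCount hs) (toffoliCount-++ R gs)) (+-assoc (toffoliCount R) _ _))

toffoliCount-[_] : ∀ g → toffoliCount (g ∷ []) ≡ toffoliCost (length (ctrl g))
toffoliCount-[ g ] = trans (+-identityʳ _) (gateCost≡toffoliCost g)

toffoliCount-≤1-control : ∀ gs → All (λ g → length (ctrl g) ≤ 1) gs → toffoliCount gs ≡ 0
toffoliCount-≤1-control [] [] = refl
toffoliCount-≤1-control (g ∷ gs) (few ∷ fews) =
  cong₂ _+_ (trans (gateCost≡toffoliCost g) (≤1⇒cost≡0 few)) (toffoliCount-≤1-control gs fews)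
  where
  ≤1⇒cost≡0 : ∀ {k} → k ≤ 1 → toffoliCost k ≡ 0
  ≤1⇒cost≡0 z≤n = refl
  ≤1⇒cost≡0 (s≤s z≤n) = refl

toffoliCount-++-≤1-control : ∀ {gs} hs → All (λ g → length (ctrl g) ≤ 1) gs → toffoliCount (gs ++ hs) ≡ toffoliCount hs
toffoliCount-++-≤1-control {gs} hs cheap =
  trans (toffoliCount-++ gs hs) (cong (_+ toffoliCount hs) (toffoliCount-≤1-control gs cheap))

h≤⇒nbit≡1 : ∀ n m x k → m ≤ n → h n m ≤ x → x < 2 ^ n → 1 ≤ k → k < m → nbit n x k ≡ 1
h≤⇒nbit≡1 n m x k m≤n lo hi 1≤k k<m = bitAt-top-block (n ∸ k) k x 1≤k lo′ hi′
  where
  e+k≡n : n ∸ k + k ≡ n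
  e+k≡n = m∸n+n≡m (≤-trans (<⇒≤ k<m) m≤n)
  hi′ : x < 2 ^ (n ∸ k + k)
  hi′ = subst (λ z → x < 2 ^ z) (sym e+k≡n) hi
  exp≤ : n ∸ m + 1 ≤ n ∸ k
  exp≤ = begin
    n ∸ m + 1          ≤⟨ +-monoˡ-≤ 1 (∸-monoʳ-≤ n k<m) ⟩
    n ∸ suc k + 1      ≡⟨ +-comm (n ∸ suc k) 1 ⟩
    suc (n ∸ suc k)    ≡⟨ +-∸-assoc 1 (≤-trans k<m m≤n) ⟨
    n ∸ k              ∎
    where open ≤-Reasoning
  lo′ : 2 ^ (n ∸ k + k) ∸ 2 ^ (n ∸ k) ≤ x
  lo′ = ≤-trans (subst (λ z → 2 ^ z ∸ 2 ^ (n ∸ k) ≤ h n m) (sym e+k≡n)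
                       (∸-monoʳ-≤ (2 ^ n) (^-monoʳ-≤ 2 exp≤))) lo

-- consGates n m i α β reduces to consBody n m i α β δ for the first bit δ where α and β differ (n if none).
bitsDiffer : ℕ → ℕ → ℕ → ℕ → Bool
bitsDiffer n α β k = not (nbit n α k ≡ᵇ nbit n β k)

consX : ℕ → ℕ → ℕ → List Gate
consX n i δ = if tbit n i δ ≡ᵇ 1 then CX [] δ ∷ [] else []

consCNOTs : ℕ → ℕ → ℕ → ℕ → List Gate
consCNOTs n α β δ = map (λ k → CX (δ ∷ []) k) (filterᵇ (bitsDiffer n α β) (range (suc δ) n))

consToffoli : ℕ → ℕ → ℕ → Gate
consToffoli n m δ = CX (range 1 m ++ (n ∷ [])) δ

consBody : ℕ → ℕ → ℕ → ℕ → ℕ → ℕ → List Gate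
consBody n m i α β δ =
  if δ ≡ᵇ n then [] else consX n i δ ++ consCNOTs n α β δ ++ consX n i δ ++ (consToffoli n m δ ∷ [])

consCost : ℕ → ℕ → ℕ
consCost n m = if m ≡ᵇ n then 0 else toffoliCost m

-- The column bound i ≤ ⌊ Y /2⌋ is what ALLOC needs: it forces i to have a 0 where it first differs from ⌊ Y /2⌋.
record ConsSpec (n m i j : ℕ) (gs : List Gate) : Set where
  field
    all-valid : All (ValidGate n) gs
    cost≤     : toffoliCount gs ≤ consCost n m
    i≤col/2   : i ≤ ⌊ moveCol n gs j /2⌋

consSpec-[] : ∀ n m i j → 2 * i ≤ j → ConsSpec n m i j []
consSpec-[] n m i j 2i≤j = record { all-valid = [] ; cost≤ = z≤n ; i≤col/2 = 2m≤n⇒m≤⌊n/2⌋ i j 2i≤j }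

moveCol-CNOTs-idle : ∀ n δ ks x → bitAt x (n ∸ δ) ≡ 0 → moveCol n (map (λ k → CX (δ ∷ []) k) ks) x ≡ x
moveCol-CNOTs-idle n δ [] x x₀ = refl
moveCol-CNOTs-idle n δ (k ∷ ks) x x₀ =
  trans (cong (moveCol n (map (λ k → CX (δ ∷ []) k) ks)) (if-false (cong (λ b → (b ≡ᵇ 1) ∧ true) x₀)))
        (moveCol-CNOTs-idle n δ ks x x₀)

toffoliCost-length-consToffoli : ∀ n m δ → toffoliCost (length (ctrl (consToffoli n m δ))) ≡ toffoliCost m
toffoliCost-length-consToffoli n m δ =
  trans (cong toffoliCost (trans (length-++ (range 1 m)) (cong (_+ 1) (length-applyUpTo _ (m ∸ 1))))) (lemma m)
  where
  lemma : ∀ m → toffoliCost (m ∸ 1 + 1) ≡ toffoliCost m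
  lemma zero = refl
  lemma (suc m) = cong toffoliCost (+-comm m 1)

module ConsFirstDiff (n m i j t δ : ℕ) (m≤n : m ≤ n) (2i≤h : 2 * i ≤ h n m) (h≤j : h n m ≤ j)
  (j<t : j < t) (t<2^n : t < 2 ^ n) (1≤δ : 1 ≤ δ) (δ<n : δ < n)
  (differ : bitsDiffer n j t δ ≡ true) (agree : ∀ k → 1 ≤ k → k < δ → bitsDiffer n j t k ≡ false) where

  j<2^n : j < 2 ^ n
  j<2^n = <-trans j<t t<2^n

  E : ℕ
  E = n ∸ δ

  m≤δ : m ≤ δ
  m≤δ with m ≤? δ
  ... | yes m≤δ = m≤δ
  ... | no m≰δ = ⊥-elim (not-≡ᵇ-true⇒≢ _ _ differ (trans j₁ (sym t₁)))
    where
    j₁ : nbit n j δ ≡ 1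
    j₁ = h≤⇒nbit≡1 n m j δ m≤n h≤j j<2^n 1≤δ (≰⇒> m≰δ)
    t₁ : nbit n t δ ≡ 1
    t₁ = h≤⇒nbit≡1 n m t δ m≤n (≤-trans h≤j (<⇒≤ j<t)) t<2^n 1≤δ (≰⇒> m≰δ)

  j₀ : bitAt j E ≡ 0
  j₀ = first-difference-bitAt≡0 E (<⇒≤ j<t)
         (nbit-agree⇒shiftR≡ n j t δ j<2^n t<2^n 1≤δ (<⇒≤ δ<n) (λ k 1≤k k<δ → not-≡ᵇ-false⇒≡ _ _ (agree k 1≤k k<δ)))
         (not-≡ᵇ-true⇒≢ _ _ differ)

  toffoli : Gate
  toffoli = consToffoli n m δ

  xs cnots gates : List Gate
  xs = consX n i δ
  cnots = consCNOTs n j t δ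
  gates = xs ++ cnots ++ xs ++ (toffoli ∷ [])

  All-gates : ∀ {P : Gate → Set} → All P xs → All P cnots → P toffoli → All P gates
  All-gates Pxs Pcnots Ptoffoli = ++⁺ Pxs (++⁺ Pcnots (++⁺ Pxs (Ptoffoli ∷ [])))

  All-xs : ∀ {P : Gate → Set} → P (CX [] δ) → All P xs
  All-xs P-X with tbit n i δ ≡ᵇ 1
  ... | true = P-X ∷ []
  ... | false = []

  All-cnots : ∀ {P : Gate → Set} → (∀ k → δ < k → k < n → P (CX (δ ∷ []) k)) → All P cnots
  All-cnots P-CX = map⁺ (All-filterᵇ (bitsDiffer n j t) (All-range (suc δ) n P-CX))

  gates-valid : All (ValidGate n) gates
  gates-valid = All-gates (All-xs (X-valid 1≤δ (<⇒≤ δ<n)))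
    (All-cnots (λ k δ<k k<n → CNOT-valid δ<k (<⇒≤ k<n)))
    (valid 1≤δ (<⇒≤ δ<n) (++⁺
      (All-range 1 m (λ c _ c<m → ≤-trans (<⇒≤ c<m) m≤n , λ c≡δ → <-irrefl c≡δ (<-≤-trans c<m m≤δ)))
      ((≤-refl , λ n≡δ → <-irrefl (sym n≡δ) δ<n) ∷ [])))

  cost≡ : toffoliCount gates ≡ toffoliCost m
  cost≡ = begin
    toffoliCount gates                           ≡⟨ toffoliCount-++-≤1-control _ (All-xs z≤n) ⟩
    toffoliCount (cnots ++ xs ++ toffoli ∷ [])   ≡⟨ toffoliCount-++-≤1-control _ (All-cnots (λ _ _ _ → ≤-refl)) ⟩
    toffoliCount (xs ++ toffoli ∷ [])            ≡⟨ toffoliCount-++-≤1-control _ (All-xs z≤n) ⟩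
    toffoliCount (toffoli ∷ [])                  ≡⟨ toffoliCount-[ toffoli ] ⟩
    toffoliCost (length (ctrl toffoli))          ≡⟨ toffoliCost-length-consToffoli n m δ ⟩
    toffoliCost m                                ∎
    where open ≡-Reasoning

  cost≤ : toffoliCount gates ≤ consCost n m
  cost≤ = ≤-reflexive (trans cost≡ (sym (if-false (≢⇒≡ᵇ-false m n (λ m≡n → <-irrefl m≡n (≤-<-trans m≤δ δ<n))))))

  i≤j/2 : i ≤ ⌊ j /2⌋
  i≤j/2 = 2m≤n⇒m≤⌊n/2⌋ i j (≤-trans 2i≤h h≤j)

  -- Without the X gates only the final gate can move a, and it can only set bit δ of its column.
  i≤col/2-without-X : xs ≡ [] → i ≤ ⌊ moveCol n gates j /2⌋
  i≤col/2-without-X xs≡[] rewrite xs≡[] = ≤-trans i≤j/2 (⌊n/2⌋-mono (subst (j ≤_) (sym moved) (gateAct-≥ n toffoli j j₀)))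
    where
    moved : moveCol n (cnots ++ toffoli ∷ []) j ≡ gateAct n toffoli j
    moved = trans (moveCol-++ n cnots (toffoli ∷ []) j)
                  (cong (gateAct n toffoli) (moveCol-CNOTs-idle n δ (filterᵇ (bitsDiffer n j t) (range (suc δ) n)) j j₀))

  -- With the X gates, i has bit δ set while j does not, and the gates leave the bits above δ alone.
  i≤col/2-with-X : tbit n i δ ≡ 1 → i ≤ ⌊ moveCol n gates j /2⌋
  i≤col/2-with-X i₁ = <⇒≤ (shiftR-<⇒< (suc e) (subst (shiftR i (suc e) <_) same-prefix i<j))
    where
    Y e : ℕ
    Y = moveCol n gates j
    e = (n ∸ 1) ∸ δ
    1+e≡E : suc e ≡ E
    1+e≡E = trans (cong suc (∸-+-assoc n 1 δ)) (sym (+-∸-assoc 1 δ<n))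
    j/2₀ : bitAt ⌊ j /2⌋ e ≡ 0
    j/2₀ = trans (cong (λ z → shiftR j z % 2) 1+e≡E) j₀
    i<j : shiftR i (suc e) < shiftR ⌊ j /2⌋ (suc e)
    i<j = bit-1-0⇒shiftR-suc-< e i≤j/2 i₁ j/2₀
    targets≥δ : All (λ g → δ ≤ tgt g) gates
    targets≥δ = All-gates (All-xs ≤-refl) (All-cnots (λ _ δ<k _ → <⇒≤ δ<k)) ≤-refl
    same-prefix : shiftR ⌊ j /2⌋ (suc e) ≡ shiftR ⌊ Y /2⌋ (suc e)
    same-prefix = begin
      shiftR j (suc (suc e))   ≡⟨ cong (λ z → shiftR j (suc z)) 1+e≡E ⟩
      shiftR j (suc E)         ≡⟨ moveCol-above n gates j targets≥δ ⟨
      shiftR Y (suc E)         ≡⟨ cong (λ z → shiftR Y (suc z)) 1+e≡E ⟨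
      shiftR Y (suc (suc e))   ∎
      where open ≡-Reasoning

  i≤col/2 : i ≤ ⌊ moveCol n gates j /2⌋
  i≤col/2 with m%2≡0⊎m%2≡1 (shiftR i ((n ∸ 1) ∸ δ))
  ... | inj₁ i₀ = i≤col/2-without-X (cong (λ b → if b ≡ᵇ 1 then CX [] δ ∷ [] else []) i₀)
  ... | inj₂ i₁ = i≤col/2-with-X i₁

  spec : ConsSpec n m i j gates
  spec = record { all-valid = gates-valid ; cost≤ = cost≤ ; i≤col/2 = i≤col/2 }

consGates-spec : ∀ n m i j t → m ≤ n → 2 * i ≤ h n m → h n m ≤ j → j < t → t < 2 ^ n →
                 ConsSpec n m i j (consGates n m i j t)
consGates-spec n m i j t m≤n 2i≤h h≤j j<t t<2^n =
  spec-at (firstWith (bitsDiffer n j t) (range 1 (suc n))) refl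
  where
  2i≤j : 2 * i ≤ j
  2i≤j = ≤-trans 2i≤h h≤j
  body-spec : ∀ δ → FirstMatch (bitsDiffer n j t) (1 +_) n δ → ConsSpec n m i j (consBody n m i j t δ)
  body-spec δ δ-first with δ ≡ᵇ n in δ≟n
  ... | true = consSpec-[] n m i j 2i≤j
  ... | false = ConsFirstDiff.spec n m i j t δ m≤n 2i≤h h≤j j<t t<2^n 1≤δ δ<n matches earlier′
    where
    open FirstMatch δ-first
    1≤δ : 1 ≤ δ
    1≤δ = subst (1 ≤_) (sym x≡) (s≤s z≤n)
    δ<n : δ < n
    δ<n = ≤∧≢⇒< (subst (_≤ n) (sym x≡) index<K) (≡ᵇ-false⇒≢ δ n δ≟n)
    earlier′ : ∀ k → 1 ≤ k → k < δ → bitsDiffer n j t k ≡ false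
    earlier′ (suc k) _ k<δ = earlier k (≤-pred (subst (suc k <_) x≡ k<δ))
  spec-at : ∀ found → firstWith (bitsDiffer n j t) (range 1 (suc n)) ≡ found →
            ConsSpec n m i j (consGates n m i j t)
  spec-at nothing none = subst (ConsSpec n m i j)
    (sym (trans (cong (λ d → consBody n m i j t (fromMaybe n d)) none) (if-true (≡ᵇ-refl n))))
    (consSpec-[] n m i j 2i≤j)
  spec-at (just δ) found = subst (ConsSpec n m i j)
    (sym (cong (λ d → consBody n m i j t (fromMaybe n d)) found))
    (body-spec δ (firstWith-just⇒FirstMatch (bitsDiffer n j t) (1 +_) n found))

popCount : ℕ → ℕ → ℕ
popCount zero i = 0
popCount (suc L) i = bitAt i L + popCount L i

popCount-mono-≤ : ∀ i {e L} → e ≤ L → popCount e i ≤ popCount L i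
popCount-mono-≤ i {e} {zero} z≤n = ≤-refl
popCount-mono-≤ i {e} {suc L} e≤ with e ≟ suc L
... | yes refl = ≤-refl
... | no e≢ = ≤-trans (popCount-mono-≤ i (≤-pred (≤∧≢⇒< e≤ e≢))) (m≤n+m _ (bitAt i L))

length-filter-bits : ∀ N i δ d → δ + d ≡ N →
  length (filterᵇ (λ k → bitAt i (N ∸ k) ≡ᵇ 1) (range (suc δ) (suc N))) ≡ popCount d i
length-filter-bits N i δ zero δ≡N =
  cong (length ∘ filterᵇ _)
       (range-empty (suc δ) (suc N) (s≤s (≤-reflexive (trans (sym δ≡N) (+-identityʳ δ)))))
length-filter-bits N i δ (suc d) δ+d≡N = begin
  length (filterᵇ p (range (suc δ) (suc N)))
    ≡⟨ cong (length ∘ filterᵇ p) (range-∷ (suc δ) (suc N) (s≤s δ<N)) ⟩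
  length (filterᵇ p (suc δ ∷ range (2 + δ) (suc N)))
    ≡⟨ head-bit ⟩
  bitAt i (N ∸ suc δ) + length (filterᵇ p (range (2 + δ) (suc N)))
    ≡⟨ cong₂ _+_ (cong (bitAt i) N∸δ≡d) (length-filter-bits N i (suc δ) d (trans (sym (+-suc δ d)) δ+d≡N)) ⟩
  bitAt i d + popCount d i
    ∎
  where
  open ≡-Reasoning
  p : ℕ → Bool
  p k = bitAt i (N ∸ k) ≡ᵇ 1
  δ<N : δ < N
  δ<N = subst (δ <_) δ+d≡N (m<m+n δ z<s)
  N∸δ≡d : N ∸ suc δ ≡ d
  N∸δ≡d = trans (cong (_∸ suc δ) (trans (sym δ+d≡N) (+-suc δ d))) (m+n∸m≡n (suc δ) d)
  head-bit : length (filterᵇ p (suc δ ∷ range (2 + δ) (suc N)))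
           ≡ bitAt i (N ∸ suc δ) + length (filterᵇ p (range (2 + δ) (suc N)))
  head-bit with m%2≡0⊎m%2≡1 (shiftR i (N ∸ suc δ))
  ... | inj₁ b₀ rewrite b₀ = refl
  ... | inj₂ b₁ rewrite b₁ = refl

allocBound : ℕ → ℕ → ℕ
allocBound zero i = 0
allocBound (suc L) i = if bitAt i L ≡ᵇ 0 then toffoliCost (popCount L i) else allocBound L i

allocBound-≥ : ∀ L i e → e < L → bitAt i e ≡ 0 → toffoliCost (popCount e i) ≤ allocBound L i
allocBound-≥ (suc L) i e e<1+L i₀ with bitAt i L ≡ᵇ 0 in top
... | true = toffoliCost-mono-≤ (popCount-mono-≤ i (≤-pred e<1+L))
... | false with e ≟ L
...   | yes refl = ⊥-elim (subst T top (subst (λ b → T (b ≡ᵇ 0)) (sym i₀) _))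
...   | no e≢L = allocBound-≥ L i e (≤∧≢⇒< (≤-pred e<1+L) e≢L) i₀

-- allocGates n i s reduces to allocBody n i s δ for the first bit δ where s and i differ (n if none).
allocDiffer : ℕ → ℕ → ℕ → ℕ → Bool
allocDiffer n i s k = not (tbit n s k ≡ᵇ tbit n i k)

allocCNOTs : ℕ → ℕ → ℕ → ℕ → List Gate
allocCNOTs n i s δ = map (λ k → CX (δ ∷ []) k) (filterᵇ (allocDiffer n i s) (range (suc δ) n))

allocToffoli : ℕ → ℕ → ℕ → Gate
allocToffoli n i δ = CX (filterᵇ (λ k → tbit n i k ≡ᵇ 1) (range (suc δ) n)) δ

allocBody : ℕ → ℕ → ℕ → ℕ → List Gate
allocBody n i s δ = if s ≡ᵇ i then [] else allocCNOTs n i s δ ++ (allocToffoli n i δ ∷ [])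

AllocSpec : ℕ → ℕ → List Gate → Set
AllocSpec n i gs = All (ValidGate n) gs × toffoliCount gs ≤ allocBound (n ∸ 1) i

allocFirstDiff-spec : ∀ N i s δ → i < 2 ^ N → s < 2 ^ N → i ≤ s → FirstMatch (allocDiffer (suc N) i s) (1 +_) N δ →
                      AllocSpec (suc N) i (allocCNOTs (suc N) i s δ ++ (allocToffoli (suc N) i δ ∷ []))
allocFirstDiff-spec N i s δ i<2^N s<2^N i≤s δ-first = ++⁺ cnots-valid (toffoli-valid ∷ []) , cost≤
  where
  open FirstMatch δ-first
  n : ℕ
  n = suc N
  1≤δ : 1 ≤ δ
  1≤δ = subst (1 ≤_) (sym x≡) (s≤s z≤n)
  δ≤N : δ ≤ N
  δ≤N = subst (_≤ N) (sym x≡) index<K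
  e : ℕ
  e = N ∸ δ
  prefix : shiftR i (suc e) ≡ shiftR s (suc e)
  prefix = sym (nbit-agree⇒shiftR≡ N s i δ s<2^N i<2^N 1≤δ δ≤N
             (λ { (suc k) _ k<δ → not-≡ᵇ-false⇒≡ _ _ (earlier k (≤-pred (subst (suc k <_) x≡ k<δ))) }))
  i₀ : bitAt i e ≡ 0
  i₀ = first-difference-bitAt≡0 e i≤s prefix (λ eq → not-≡ᵇ-true⇒≢ _ _ matches (sym eq))
  cnots-valid : All (ValidGate n) (allocCNOTs n i s δ)
  cnots-valid = map⁺ (All-filterᵇ (allocDiffer n i s) (All-range (suc δ) n (λ k δ<k k<n → CNOT-valid δ<k (<⇒≤ k<n))))
  toffoli-valid : ValidGate n (allocToffoli n i δ)
  toffoli-valid = valid 1≤δ (≤-trans δ≤N (n≤1+n N)) (All-filterᵇ _ (All-range (suc δ) n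
    (λ k δ<k k<n → <⇒≤ k<n , λ k≡δ → <-irrefl (sym k≡δ) δ<k)))
  cnots-cheap : All (λ g → length (ctrl g) ≤ 1) (allocCNOTs n i s δ)
  cnots-cheap = map⁺ (All-filterᵇ (allocDiffer n i s) (All-range (suc δ) n (λ _ _ _ → ≤-refl)))
  cost≤ : toffoliCount (allocCNOTs n i s δ ++ (allocToffoli n i δ ∷ [])) ≤ allocBound N i
  cost≤ = begin
    toffoliCount (allocCNOTs n i s δ ++ (allocToffoli n i δ ∷ []))
      ≡⟨ toffoliCount-++-≤1-control _ cnots-cheap ⟩
    toffoliCount (allocToffoli n i δ ∷ [])
      ≡⟨ toffoliCount-[ allocToffoli n i δ ] ⟩
    toffoliCost (length (ctrl (allocToffoli n i δ)))
      ≡⟨ cong toffoliCost (length-filter-bits N i δ e (m+[n∸m]≡n δ≤N)) ⟩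
    toffoliCost (popCount e i)
      ≤⟨ allocBound-≥ N i e (∸-monoʳ-< 1≤δ δ≤N) i₀ ⟩
    allocBound N i
      ∎
    where open ≤-Reasoning

allocGates-spec : ∀ N i s → i < 2 ^ N → s < 2 ^ N → i ≤ s → AllocSpec (suc N) i (allocGates (suc N) i s)
allocGates-spec N i s i<2^N s<2^N i≤s = by-cases (s ≡ᵇ i) refl
  where
  n : ℕ
  n = suc N
  spec-at : ∀ found → firstWith (allocDiffer n i s) (range 1 n) ≡ found →
            (s ≡ᵇ i) ≡ false → AllocSpec n i (allocGates n i s)
  by-cases : ∀ b → (s ≡ᵇ i) ≡ b → AllocSpec n i (allocGates n i s)
  by-cases true s≡i = subst (AllocSpec n i) (sym (if-true s≡i)) ([] , z≤n)
  by-cases false s≢i = spec-at (firstWith (allocDiffer n i s) (range 1 n)) refl s≢i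
  spec-at nothing none s≟i = subst (AllocSpec n i) (sym gates≡) ((X-valid (s≤s z≤n) ≤-refl ∷ []) , z≤n)
    where
    nothing-above-n : range (suc n) n ≡ []
    nothing-above-n = range-empty (suc n) n (n≤1+n n)
    gates≡ : allocGates n i s ≡ CX [] n ∷ []
    gates≡ = trans (cong (λ d → allocBody n i s (fromMaybe n d)) none)
      (trans (if-false s≟i)
        (cong (λ ks → map (λ k → CX (n ∷ []) k) (filterᵇ (allocDiffer n i s) ks)
                      ++ (CX (filterᵇ (λ k → tbit n i k ≡ᵇ 1) ks) n ∷ [])) nothing-above-n))
  spec-at (just δ) found s≟i = subst (AllocSpec n i)
    (sym (trans (cong (λ d → allocBody n i s (fromMaybe n d)) found) (if-false s≟i)))
    (allocFirstDiff-spec N i s δ i<2^N s<2^N i≤s (firstWith-just⇒FirstMatch (allocDiffer n i s) (1 +_) N found))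

h[1+n]1≡0 : ∀ n → h (suc n) 1 ≡ 0
h[1+n]1≡0 n = trans (cong (λ z → 2 ^ suc n ∸ 2 ^ z) (+-comm n 1)) (n∸n≡0 (2 ^ suc n))

h[1+n][1+m] : ∀ n m → 1 ≤ m → m ≤ n → h (suc n) (suc m) ≡ 2 ^ n + h n m
h[1+n][1+m] n m 1≤m m≤n = begin
  2 * 2 ^ n ∸ 2 ^ (n ∸ m + 1)            ≡⟨ cong (_∸ 2 ^ (n ∸ m + 1)) (cong (2 ^ n +_) (+-identityʳ (2 ^ n))) ⟩
  2 ^ n + 2 ^ n ∸ 2 ^ (n ∸ m + 1)        ≡⟨ +-∸-assoc (2 ^ n) (^-monoʳ-≤ 2 exp≤n) ⟩
  2 ^ n + h n m                          ∎
  where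
  open ≡-Reasoning
  exp≤n : n ∸ m + 1 ≤ n
  exp≤n = subst (_≤ n) (+-comm 1 (n ∸ m)) (∸-monoʳ-< 1≤m m≤n)

record IsMOf (n i m : ℕ) : Set where
  field
    1≤m   : 1 ≤ m
    m≤n   : m ≤ n
    fits  : 2 * i ≤ h n m
    least : ∀ m′ → 1 ≤ m′ → m′ < m → h n m′ < 2 * i

mOf-unique : ∀ n i m → IsMOf n i m → mOf n i ≡ m
mOf-unique n i m isM = cong (fromMaybe n) (trans
  (firstWith-applyUpTo (λ k → 2 * i ≤ᵇ h n k) (1 +_) n (m ∸ 1) (<-≤-trans (∸-monoʳ-< z<s 1≤m) m≤n)
    (subst (λ k → (2 * i ≤ᵇ h n k) ≡ true) (sym 1+[m∸1]≡m) (≤⇒≤ᵇ≡true fits))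
    (λ k k< → >⇒≤ᵇ≡false (least (suc k) (s≤s z≤n) (subst (suc k <_) 1+[m∸1]≡m (s<s k<)))))
  (cong just 1+[m∸1]≡m))
  where
  open IsMOf isM
  1+[m∸1]≡m : 1 + (m ∸ 1) ≡ m
  1+[m∸1]≡m = m+[n∸m]≡n 1≤m

mOf-isMOf : ∀ N i → i < 2 ^ N → IsMOf (suc N) i (mOf (suc N) i)
mOf-isMOf N i i<2^N = spec-at (firstWith fits? (range 1 (suc n))) refl
  where
  n : ℕ
  n = suc N
  fits? : ℕ → Bool
  fits? m = 2 * i ≤ᵇ h n m
  2i≤h-n : 2 * i ≤ h n n
  2i≤h-n = subst (λ z → 2 * i ≤ 2 ^ n ∸ 2 ^ (z + 1)) (sym (n∸n≡0 n))
    (m+n≤o⇒m≤o∸n (2 * i) (subst (_≤ 2 ^ n) (trans (*-suc 2 i) (+-comm 2 (2 * i))) (*-monoʳ-≤ 2 i<2^N)))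
  spec-at : ∀ found → firstWith fits? (range 1 (suc n)) ≡ found → IsMOf n i (mOf n i)
  spec-at nothing none = ⊥-elim (subst T (firstWith-nothing fits? (1 +_) n none N ≤-refl) (≤⇒≤ᵇ 2i≤h-n))
  spec-at (just m) found = subst (IsMOf n i) (sym (cong (fromMaybe n) found)) (record
    { 1≤m = subst (1 ≤_) (sym x≡) (s≤s z≤n)
    ; m≤n = subst (_≤ n) (sym x≡) index<K
    ; fits = ≤ᵇ≡true⇒≤ (2 * i) (h n m) matches
    ; least = λ { (suc m′) _ m′< → ≰⇒> (λ le → subst T (earlier m′ (≤-pred (subst (suc m′ <_) x≡ m′<))) (≤⇒≤ᵇ le)) }
    })
    where open FirstMatch (firstWith-just⇒FirstMatch fits? (1 +_) n found)

mOf-upper : ∀ N i → i < 2 ^ N → mOf (2 + N) (2 ^ N + i) ≡ suc (mOf (suc N) i)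
mOf-upper N i i<2^N = mOf-unique (2 + N) (2 ^ N + i) (suc m) (record
  { 1≤m = s≤s z≤n
  ; m≤n = s≤s m≤n
  ; fits = begin
      2 * (2 ^ N + i)          ≡⟨ *-distribˡ-+ 2 (2 ^ N) i ⟩
      2 ^ suc N + 2 * i        ≤⟨ +-monoʳ-≤ (2 ^ suc N) fits ⟩
      2 ^ suc N + h (suc N) m  ≡⟨ h[1+n][1+m] (suc N) m 1≤m m≤n ⟨
      h (2 + N) (suc m)        ∎
  ; least = least′
  })
  where
  open ≤-Reasoning
  m : ℕ
  m = mOf (suc N) i
  open IsMOf (mOf-isMOf N i i<2^N)
  least′ : ∀ m′ → 1 ≤ m′ → m′ < suc m → h (2 + N) m′ < 2 * (2 ^ N + i)
  least′ (suc zero) _ _ = subst (_< 2 * (2 ^ N + i)) (sym (h[1+n]1≡0 (suc N)))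
    (*-monoʳ-< 2 (<-≤-trans (m^n>0 2 N) (m≤m+n (2 ^ N) i)))
  least′ (suc (suc m′)) _ (s<s m′<m) = begin-strict
    h (2 + N) (2 + m′)            ≡⟨ h[1+n][1+m] (suc N) (suc m′) (s≤s z≤n) (≤-trans (<⇒≤ m′<m) m≤n) ⟩
    2 ^ suc N + h (suc N) (suc m′) <⟨ +-monoʳ-< (2 ^ suc N) (least (suc m′) (s≤s z≤n) m′<m) ⟩
    2 ^ suc N + 2 * i             ≡⟨ *-distribˡ-+ 2 (2 ^ N) i ⟨
    2 * (2 ^ N + i)               ∎

mOf-lower : ∀ N i → 1 ≤ i → i < 2 ^ N → mOf (2 + N) i ≡ 2
mOf-lower N i 1≤i i<2^N = mOf-unique (2 + N) i 2 (record
  { 1≤m = s≤s z≤n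
  ; m≤n = s≤s (s≤s z≤n)
  ; fits = subst (2 * i ≤_) (sym h₂) (*-monoʳ-≤ 2 (<⇒≤ i<2^N))
  ; least = λ { (suc zero) _ _ → subst (_< 2 * i) (sym (h[1+n]1≡0 (suc N))) (*-monoʳ-< 2 1≤i)
              ; (suc (suc _)) _ (s<s (s<s ())) }
  })
  where
  h₂ : h (2 + N) 2 ≡ 2 * 2 ^ N
  h₂ = trans (h[1+n][1+m] (suc N) 1 ≤-refl (s≤s z≤n))
             (trans (cong (2 ^ suc N +_) (h[1+n]1≡0 N)) (+-identityʳ _))

record PickSpec (n m : ℕ) (r : ℕ → ℕ) (j : ℕ) : Set where
  field
    h≤j     : h n m ≤ j
    t       : ℕ
    j<t     : j < t
    t<2^n   : t < 2 ^ n
    partner : r t ≡ lsbFlip (r j)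

pickJ-spec : ∀ n m r j → pickJ n m r ≡ just j → PickSpec n m r j
pickJ-spec n m r j picked = spec (any-applyUpTo⇒∃ is-partner (suc j +_) (2 ^ n ∸ suc j) matches)
  where
  open FirstMatch (firstWith-just⇒FirstMatch _ (h n m +_) ((2 ^ n ∸ 1) ∸ h n m) picked)
  is-partner : ℕ → Bool
  is-partner t = r t ≡ᵇ lsbFlip (r j)
  spec : ∃[ t′ ] (t′ < 2 ^ n ∸ suc j × is-partner (suc j + t′) ≡ true) → PickSpec n m r j
  spec (t′ , t′< , partner) = record
    { h≤j = subst (h n m ≤_) (sym x≡) (m≤m+n (h n m) index)
    ; t = suc j + t′
    ; j<t = s≤s (m≤m+n j t′)
    ; t<2^n = j<b∸a⇒a+j<b (suc j) (2 ^ n) t′<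
    ; partner = ≡ᵇ-true⇒≡ _ _ partner
    }

iterationBound : ℕ → ℕ → ℕ
iterationBound N i = consCost (suc N) (mOf (suc N) i) + allocBound N i

StepInvariant : ℕ → List Gate → ℕ → State → Set
StepInvariant N R bound (r′ , R′) = InjectiveOn (suc N) r′ × toffoliCount R′ ≤ toffoliCount R + bound

step-spec : ∀ N r R i → i < 2 ^ N → InjectiveOn (suc N) r →
            StepInvariant N R (iterationBound N i) (step (suc N) (r , R) i)
step-spec N r R i i<2^N inj with pickJ (suc N) (mOf (suc N) i) r in picked
... | nothing = inj , m≤m+n _ _
... | just j = applyGates-injectiveOn n r₁ allocs (proj₁ alloc-spec) (applyGates-injectiveOn n r conss cons-valid inj)
             , subst (_≤ toffoliCount R + iterationBound N i) (sym (toffoliCount-++-++ R conss allocs))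
                     (+-monoʳ-≤ (toffoliCount R) (+-mono-≤ cons-cost≤ (proj₂ alloc-spec)))
  where
  n m : ℕ
  n = suc N
  m = mOf n i
  open IsMOf (mOf-isMOf N i i<2^N) using (m≤n; fits)
  open PickSpec (pickJ-spec n m r j picked)
  j<2^n : j < 2 ^ n
  j<2^n = <-trans j<t t<2^n
  conss : List Gate
  conss = consGates n m i (colOf n r (r j)) (colOf n r (lsbFlip (r j)))
  conss≡ : conss ≡ consGates n m i j t
  conss≡ = cong₂ (consGates n m i) (colOf-row n r j inj j<2^n)
                 (trans (cong (colOf n r) (sym partner)) (colOf-row n r t inj t<2^n))
  open ConsSpec (subst (ConsSpec n m i j) (sym conss≡)
                       (consGates-spec n m i j t m≤n fits h≤j j<t t<2^n))
    renaming (all-valid to cons-valid; cost≤ to cons-cost≤)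
  r₁ : ℕ → ℕ
  r₁ = applyGates n r conss
  Y : ℕ
  Y = moveCol n conss j
  col≡Y : colOf n r₁ (r j) ≡ Y
  col≡Y = colOf-applyGates n r conss j inj cons-valid j<2^n
  allocs : List Gate
  allocs = allocGates n i ⌊ colOf n r₁ (r j) /2⌋
  alloc-spec : AllocSpec n i allocs
  alloc-spec = subst (λ y → AllocSpec n i (allocGates n i ⌊ y /2⌋)) (sym col≡Y)
    (allocGates-spec N i ⌊ Y /2⌋ i<2^N (m<2n⇒⌊m/2⌋<n Y (2 ^ N) (moveCol-<2^ n conss j cons-valid j<2^n)) i≤col/2)

loop-bound : ∀ N (is : List ℕ) r R → All (_< 2 ^ N) is → InjectiveOn (suc N) r →
  toffoliCount (proj₂ (foldl (step (suc N)) (r , R) is)) ≤ toffoliCount R + sum (map (iterationBound N) is)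
loop-bound N [] r R [] inj = m≤m+n _ _
loop-bound N (i ∷ is) r R (i< ∷ is<) inj = begin
  toffoliCount (proj₂ (foldl (step (suc N)) st is))
    ≤⟨ loop-bound N is (proj₁ st) (proj₂ st) is< (proj₁ st-spec) ⟩
  toffoliCount (proj₂ st) + sum (map (iterationBound N) is)
    ≤⟨ +-monoˡ-≤ _ (proj₂ st-spec) ⟩
  toffoliCount R + iterationBound N i + sum (map (iterationBound N) is)
    ≡⟨ +-assoc (toffoliCount R) _ _ ⟩
  toffoliCount R + sum (map (iterationBound N) (i ∷ is))
    ∎
  where
  open ≤-Reasoning
  st : State
  st = step (suc N) (r , R) i
  st-spec : StepInvariant N R (iterationBound N i) st
  st-spec = step-spec N r R i i< inj

permFun-injectiveOn : ∀ n π → InjectiveOn n (permFun n π)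
permFun-injectiveOn n π x y x< y< eq = begin
  x                    ≡⟨ toℕ-fromℕ< x< ⟨
  toℕ (fromℕ< x<)      ≡⟨ cong toℕ (trans (sym (inverseˡ π)) (trans (cong (π ⟨$⟩ˡ_) π-eq) (inverseˡ π))) ⟩
  toℕ (fromℕ< y<)      ≡⟨ toℕ-fromℕ< y< ⟩
  y                    ∎
  where
  open ≡-Reasoning
  permFun-< : ∀ z (z< : z < 2 ^ n) → permFun n π z ≡ toℕ (π ⟨$⟩ʳ fromℕ< z<)
  permFun-< z z< with z <? 2 ^ n
  ... | yes _ = refl
  ... | no z≮ = ⊥-elim (z≮ z<)
  π-eq : π ⟨$⟩ʳ fromℕ< x< ≡ π ⟨$⟩ʳ fromℕ< y<
  π-eq = toℕ-injective (trans (sym (permFun-< x x<)) (trans eq (permFun-< y y<)))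

Ared-bound : ∀ N π → toffoliCount (Ared (suc N) (permFun (suc N) π)) ≤ sum (map (iterationBound N) (upTo (2 ^ N)))
Ared-bound N π =
  loop-bound N (upTo (2 ^ N)) (permFun (suc N) π) [] (applyUpTo⁺₁ id (2 ^ N) id) (permFun-injectiveOn (suc N) π)

Σ< : ℕ → (ℕ → ℕ) → ℕ
Σ< zero g = 0
Σ< (suc K) g = g 0 + Σ< K (g ∘ suc)

sum-map-applyUpTo : ∀ (g f : ℕ → ℕ) K → sum (map g (applyUpTo f K)) ≡ Σ< K (g ∘ f)
sum-map-applyUpTo g f zero = refl
sum-map-applyUpTo g f (suc K) = cong (g (f 0) +_) (sum-map-applyUpTo g (f ∘ suc) K)

Σ<-cong : ∀ K {f g : ℕ → ℕ} → (∀ x → x < K → f x ≡ g x) → Σ< K f ≡ Σ< K g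
Σ<-cong zero f≗g = refl
Σ<-cong (suc K) f≗g = cong₂ _+_ (f≗g 0 z<s) (Σ<-cong K (λ x x< → f≗g (suc x) (s<s x<)))

Σ<-+ : ∀ a b (g : ℕ → ℕ) → Σ< (a + b) g ≡ Σ< a g + Σ< b (λ x → g (a + x))
Σ<-+ zero b g = refl
Σ<-+ (suc a) b g = trans (cong (g 0 +_) (Σ<-+ a b (g ∘ suc))) (sym (+-assoc (g 0) _ _))

Σ<-suc : ∀ K (g : ℕ → ℕ) → Σ< (suc K) g ≡ Σ< K g + g K
Σ<-suc K g = begin
  Σ< (suc K) g                          ≡⟨ cong (λ z → Σ< z g) (+-comm 1 K) ⟩
  Σ< (K + 1) g                          ≡⟨ Σ<-+ K 1 g ⟩
  Σ< K g + (g (K + 0) + 0)              ≡⟨ cong (Σ< K g +_) (trans (+-identityʳ _) (cong g (+-identityʳ K))) ⟩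
  Σ< K g + g K                          ∎
  where open ≡-Reasoning

Σ<-distrib-+ : ∀ K (f g : ℕ → ℕ) → Σ< K (λ x → f x + g x) ≡ Σ< K f + Σ< K g
Σ<-distrib-+ zero f g = refl
Σ<-distrib-+ (suc K) f g = trans (cong (f 0 + g 0 +_) (Σ<-distrib-+ K (f ∘ suc) (g ∘ suc)))
                                 (+-assoc-comm (f 0) (g 0) _ _)
  where
  +-assoc-comm : ∀ a b c d → a + b + (c + d) ≡ a + c + (b + d)
  +-assoc-comm = solve-∀

Σ<-const : ∀ K c → Σ< K (λ _ → c) ≡ K * c
Σ<-const zero c = refl
Σ<-const (suc K) c = cong (c +_) (Σ<-const K c)

halves : ∀ L (f : ℕ → ℕ) → Σ< (2 ^ suc L) f ≡ Σ< (2 ^ L) f + Σ< (2 ^ L) (λ i → f (2 ^ L + i))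
halves L f = trans (cong (λ z → Σ< z f) (cong (2 ^ L +_) (+-identityʳ (2 ^ L)))) (Σ<-+ (2 ^ L) (2 ^ L) f)

weighted : (ℕ → ℕ) → ℕ → ℕ
weighted G N = Σ< N (λ x → 2 ^ (N ∸ suc x) * G (2 + x))

-- Exactly 2^(N+1−m) of the i < 2^N have m(i) = m, for each 2 ≤ m ≤ N + 1.
Σ<-mOf : ∀ (G : ℕ → ℕ) N → Σ< (2 ^ N) (G ∘ mOf (suc N)) ≡ G 1 + weighted G N
Σ<-mOf G zero = refl
Σ<-mOf G (suc N) = begin
  Σ< (2 ^ suc N) (G ∘ mOf (2 + N))
    ≡⟨ halves N (G ∘ mOf (2 + N)) ⟩
  Σ< P (G ∘ mOf (2 + N)) + Σ< P (λ i → G (mOf (2 + N) (P + i)))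
    ≡⟨ cong₂ _+_ lower upper ⟩
  G 1 + (P ∸ 1) * G 2 + (G 2 + weighted (G ∘ suc) N)
    ≡⟨ regroup (G 1) (P ∸ 1) (G 2) (weighted (G ∘ suc) N) ⟩
  G 1 + (suc (P ∸ 1) * G 2 + weighted (G ∘ suc) N)
    ≡⟨ cong (λ z → G 1 + (z * G 2 + weighted (G ∘ suc) N)) P≡ ⟩
  G 1 + weighted G (suc N)
    ∎
  where
  open ≡-Reasoning
  P : ℕ
  P = 2 ^ N
  P≡ : suc (P ∸ 1) ≡ P
  P≡ = m+[n∸m]≡n (m^n>0 2 N)
  regroup : ∀ a k b w → a + k * b + (b + w) ≡ a + (suc k * b + w)
  regroup = solve-∀
  lower : Σ< P (G ∘ mOf (2 + N)) ≡ G 1 + (P ∸ 1) * G 2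
  lower = begin
    Σ< P (G ∘ mOf (2 + N))                               ≡⟨ cong (λ z → Σ< z (G ∘ mOf (2 + N))) P≡ ⟨
    G 1 + Σ< (P ∸ 1) (λ i → G (mOf (2 + N) (suc i)))     ≡⟨ cong (G 1 +_) (Σ<-cong (P ∸ 1) m≡2) ⟩
    G 1 + Σ< (P ∸ 1) (λ _ → G 2)                         ≡⟨ cong (G 1 +_) (Σ<-const (P ∸ 1) (G 2)) ⟩
    G 1 + (P ∸ 1) * G 2                                  ∎
    where
    m≡2 : ∀ i → i < P ∸ 1 → G (mOf (2 + N) (suc i)) ≡ G 2
    m≡2 i i< = cong G (mOf-lower N (suc i) (s≤s z≤n) (subst (suc i <_) P≡ (s<s i<)))
  upper : Σ< P (λ i → G (mOf (2 + N) (P + i))) ≡ G 2 + weighted (G ∘ suc) N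
  upper = trans (Σ<-cong P (λ i i< → cong G (mOf-upper N i i<))) (Σ<-mOf (G ∘ suc) N)

consCost-below : ∀ n m → m < n → consCost n m ≡ toffoliCost m
consCost-below n m m<n = if-false (≢⇒≡ᵇ-false m n (<⇒≢ m<n))

Σ<-consCost : ∀ k → Σ< (2 ^ (2 + k)) (consCost (3 + k) ∘ mOf (3 + k)) ≡ Nc (3 + k)
Σ<-consCost k = begin
  Σ< (2 ^ (2 + k)) (consCost n ∘ mOf n)
    ≡⟨ Σ<-mOf (consCost n) (2 + k) ⟩
  weighted (consCost n) (2 + k)
    ≡⟨ Σ<-suc (suc k) (λ x → 2 ^ (suc k ∸ x) * consCost n (2 + x)) ⟩
  Σ< (suc k) (λ x → 2 ^ (suc k ∸ x) * consCost n (2 + x)) + 2 ^ (suc k ∸ suc k) * consCost n n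
    ≡⟨ cong₂ _+_ (Σ<-cong (suc k) below) last ⟩
  Σ< (suc k) (λ x → toffoliCost (2 + x) * 2 ^ (suc k ∸ x)) + 0
    ≡⟨ +-identityʳ _ ⟩
  Σ< (suc k) (λ x → toffoliCost (2 + x) * 2 ^ (suc k ∸ x))
    ≡⟨ sum-map-applyUpTo _ (2 +_) (suc k) ⟨
  Nc n
    ∎
  where
  open ≡-Reasoning
  n : ℕ
  n = 3 + k
  below : ∀ x → x < suc k → 2 ^ (suc k ∸ x) * consCost n (2 + x) ≡ toffoliCost (2 + x) * 2 ^ (suc k ∸ x)
  below x x< = trans (cong (2 ^ (suc k ∸ x) *_) (consCost-below n (2 + x) (s<s (s<s x<))))
                     (*-comm (2 ^ (suc k ∸ x)) (toffoliCost (2 + x)))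
  last : 2 ^ (suc k ∸ suc k) * consCost n n ≡ 0
  last = trans (cong (2 ^ (suc k ∸ suc k) *_) (if-true (≡ᵇ-refl n))) (*-zeroʳ (2 ^ (suc k ∸ suc k)))

bitAt-<2^ : ∀ L i → i < 2 ^ L → bitAt i L ≡ 0
bitAt-<2^ L i i< = cong (_% 2) (<2^⇒shiftR≡0 i L i<)

bitAt-2^+ : ∀ L i → i < 2 ^ L → bitAt (2 ^ L + i) L ≡ 1
bitAt-2^+ L i i< = trans (cong (λ z → bitAt z L) (+-comm (2 ^ L) i))
                         (trans (bitAt-+2^ i L) (cong (1 ∸_) (bitAt-<2^ L i i<)))

bitAt-2^+-below : ∀ L i {e} → e < L → bitAt (2 ^ L + i) e ≡ bitAt i e
bitAt-2^+-below L i {e} e<L = trans (cong (λ z → bitAt z e) (+-comm (2 ^ L) i)) (bitAt-+2^-below i e<L)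

popCount-cong : ∀ L {x y} → (∀ e → e < L → bitAt x e ≡ bitAt y e) → popCount L x ≡ popCount L y
popCount-cong zero _ = refl
popCount-cong (suc L) same = cong₂ _+_ (same L ≤-refl) (popCount-cong L (λ e e< → same e (m<n⇒m<1+n e<)))

allocBound-cong : ∀ L {x y} → (∀ e → e < L → bitAt x e ≡ bitAt y e) → allocBound L x ≡ allocBound L y
allocBound-cong zero _ = refl
allocBound-cong (suc L) {x} {y} same =
  trans (cong (λ c → if bitAt x L ≡ᵇ 0 then toffoliCost c else allocBound L x) (popCount-cong L same′))
        (cong₂ (λ b rest → if b ≡ᵇ 0 then toffoliCost (popCount L y) else rest) (same L ≤-refl) (allocBound-cong L same′))
  where
  same′ : ∀ e → e < L → bitAt x e ≡ bitAt y e
  same′ e e< = same e (m<n⇒m<1+n e<)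

popCountSum : (ℕ → ℕ) → ℕ → ℕ
popCountSum g p = Σ< (2 ^ p) (g ∘ popCount p)

popCountSum-suc : ∀ g p → popCountSum g (suc p) ≡ popCountSum g p + popCountSum (g ∘ suc) p
popCountSum-suc g p = trans (halves p (g ∘ popCount (suc p))) (cong₂ _+_
  (Σ<-cong (2 ^ p) (λ i i< → cong (λ b → g (b + popCount p i)) (bitAt-<2^ p i i<)))
  (Σ<-cong (2 ^ p) (λ i i< → cong g (cong₂ _+_ (bitAt-2^+ p i i<) (popCount-cong p (λ e e< → bitAt-2^+-below p i e<))))))

binomialSum : (ℕ → ℕ) → ℕ → ℕ
binomialSum g p = Σ< (suc p) (λ q → (p C q) * g q)

binomialSum-suc : ∀ g p → binomialSum g (suc p) ≡ binomialSum g p + binomialSum (g ∘ suc) p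
binomialSum-suc g p = begin
  1 * g 0 + Σ< (suc p) (λ q → (suc p C suc q) * g (suc q))
    ≡⟨ cong (1 * g 0 +_) (Σ<-cong (suc p) pascal) ⟩
  1 * g 0 + Σ< (suc p) (λ q → (p C q) * g (suc q) + shifted q)
    ≡⟨ cong (1 * g 0 +_) (Σ<-distrib-+ (suc p) (λ q → (p C q) * g (suc q)) shifted) ⟩
  1 * g 0 + (binomialSum (g ∘ suc) p + Σ< (suc p) shifted)
    ≡⟨ cong (λ z → 1 * g 0 + (binomialSum (g ∘ suc) p + z)) shifted-last ⟩
  1 * g 0 + (binomialSum (g ∘ suc) p + Σ< p shifted)
    ≡⟨ regroup (1 * g 0) (binomialSum (g ∘ suc) p) (Σ< p shifted) ⟩
  1 * g 0 + Σ< p shifted + binomialSum (g ∘ suc) p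
    ∎
  where
  open ≡-Reasoning
  shifted : ℕ → ℕ
  shifted q = (p C suc q) * g (suc q)
  pascal : ∀ q → q < suc p → (suc p C suc q) * g (suc q) ≡ (p C q) * g (suc q) + shifted q
  pascal q _ = trans (cong (_* g (suc q)) (sym (nCk+nC[k+1]≡[n+1]C[k+1] p q)))
                     (*-distribʳ-+ (g (suc q)) (p C q) (p C suc q))
  shifted-last : Σ< (suc p) shifted ≡ Σ< p shifted
  shifted-last = trans (Σ<-suc p shifted)
    (trans (cong (λ c → Σ< p shifted + c * g (suc p)) (k>n⇒nCk≡0 (n<1+n p))) (+-identityʳ _))
  regroup : ∀ a b c → a + (b + c) ≡ a + c + b
  regroup = solve-∀

popCountSum≡binomialSum : ∀ p g → popCountSum g p ≡ binomialSum g p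
popCountSum≡binomialSum zero g = cong (_+ 0) (sym (+-identityʳ (g 0)))
popCountSum≡binomialSum (suc p) g = begin
  popCountSum g (suc p)
    ≡⟨ popCountSum-suc g p ⟩
  popCountSum g p + popCountSum (g ∘ suc) p
    ≡⟨ cong₂ _+_ (popCountSum≡binomialSum p g) (popCountSum≡binomialSum p (g ∘ suc)) ⟩
  binomialSum g p + binomialSum (g ∘ suc) p
    ≡⟨ binomialSum-suc g p ⟨
  binomialSum g (suc p)
    ∎
  where open ≡-Reasoning

allocTotal : ℕ → ℕ
allocTotal L = Σ< (2 ^ L) (allocBound L)

allocTotal-suc : ∀ L → allocTotal (suc L) ≡ popCountSum toffoliCost L + allocTotal L
allocTotal-suc L = trans (halves L (allocBound (suc L))) (cong₂ _+_
  (Σ<-cong (2 ^ L) (λ i i< → if-true (cong (_≡ᵇ 0) (bitAt-<2^ L i i<))))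
  (Σ<-cong (2 ^ L) (λ i i< → trans (if-false (cong (_≡ᵇ 0) (bitAt-2^+ L i i<)))
                                   (allocBound-cong L (λ e e< → bitAt-2^+-below L i e<)))))

sumFromTo-binomial : ∀ p → sumFromTo 2 p (λ i → toffoliCost i * (p C i)) ≡ binomialSum toffoliCost p
sumFromTo-binomial zero = refl
sumFromTo-binomial (suc p) = begin
  sumFromTo 2 (suc p) (λ i → toffoliCost i * (suc p C i))
    ≡⟨ sum-map-applyUpTo _ (2 +_) p ⟩
  Σ< p (λ x → toffoliCost (2 + x) * (suc p C (2 + x)))
    ≡⟨ Σ<-cong p (λ x _ → *-comm (toffoliCost (2 + x)) (suc p C (2 + x))) ⟩
  Σ< p tail
    ≡⟨ cong₂ (λ a b → a + (b + Σ< p tail)) (*-zeroʳ (suc p C 0)) (*-zeroʳ (suc p C 1)) ⟨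
  binomialSum toffoliCost (suc p)
    ∎
  where
  open ≡-Reasoning
  tail : ℕ → ℕ
  tail x = (suc p C (2 + x)) * toffoliCost (2 + x)

Na-unfold : ∀ k → Na (3 + k) ≡
            Σ< k (λ x → sumFromTo 2 (suc k ∸ x) (λ i → toffoliCost i * ((suc k ∸ x) C i)))
Na-unfold k = sum-map-applyUpTo _ (2 +_) k

allocTotal≡Na : ∀ k → allocTotal (2 + k) ≡ Na (3 + k)
allocTotal≡Na zero = refl
allocTotal≡Na (suc k) = begin
  allocTotal (3 + k)
    ≡⟨ allocTotal-suc (2 + k) ⟩
  popCountSum toffoliCost (2 + k) + allocTotal (2 + k)
    ≡⟨ cong₂ _+_ (popCountSum≡binomialSum (2 + k) toffoliCost) (allocTotal≡Na k) ⟩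
  binomialSum toffoliCost (2 + k) + Na (3 + k)
    ≡⟨ cong₂ _+_ (sym (sumFromTo-binomial (2 + k))) (Na-unfold k) ⟩
  Σ< (suc k) (λ x → sumFromTo 2 (2 + k ∸ x) (λ i → toffoliCost i * ((2 + k ∸ x) C i)))
    ≡⟨ Na-unfold (suc k) ⟨
  Na (4 + k)
    ∎
  where open ≡-Reasoning

-- NormalPositions only guarantees that PICK always succeeds; the bound holds for every permutation.
theorem1 : (n : ℕ) → 3 ≤ n → (π : Permutation′ (2 ^ n)) → NormalPositions n π →
             toffoliCount (Ared n (permFun n π)) ≤ Nc n + Na n
theorem1 _ (s≤s (s≤s (s≤s (z≤n {k})))) π _ = begin
  toffoliCount (Ared n (permFun n π))
    ≤⟨ Ared-bound N π ⟩
  sum (map (iterationBound N) (upTo (2 ^ N)))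
    ≡⟨ sum-map-applyUpTo (iterationBound N) id (2 ^ N) ⟩
  Σ< (2 ^ N) (iterationBound N)
    ≡⟨ Σ<-distrib-+ (2 ^ N) (consCost n ∘ mOf n) (allocBound N) ⟩
  Σ< (2 ^ N) (consCost n ∘ mOf n) + allocTotal N
    ≡⟨ cong₂ _+_ (Σ<-consCost k) (allocTotal≡Na k) ⟩
  Nc n + Na n
    ∎
  where
  open ≤-Reasoning
  N n : ℕ
  N = 2 + k
  n = 3 + k
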